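{- Let $(G,f)$ be a flow graph where $G=(V,E)$ is a DAG, let $u\in V$, and let $(u,v)\in E$ be an edge that is not the unique edge of maximum flow value among the edges leaving $u$. Then all safe paths whose last edge is $(u,v)$ lie on a single path; that is, for any two safe paths $P_1,P_2$ whose last edge is $(u,v)$, one of them is a suffix of the other.
   Context: $G=(V,E)$ is a directed acyclic graph without parallel edges, and each edge $e$ carries a flow value $f(e)\ge 0$. For $u\in V$ let $f_{in}(u)$ (resp. $f_{out}(u)$) be the sum of $f$ over edges entering (resp. leaving) $u$. A vertex $u$ is a source if $f_{in}(u)=0$ and a sink if $f_{out}(u)=0$; every other vertex satisfies $f_{in}(u)=f_{out}(u)$. Such $(G,f)$ is a flow graph. A flow decomposition is a finite collection of source-to-sink paths with positive real weights such that for every edge $e$ the sum of the weights of the paths containing $e$ equals $f(e)$. A path $P$ with at least one edge is $w$-safe if in every flow decomposition the total weight of the decomposition paths containing $P$ as a contiguous subpath is at least $w$; $P$ is safe if it is $w$-safe for some $w>0$. -}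

module Defs where

open import Level using (0ℓ)
open import Data.Nat using (ℕ; _≥_)
open import Data.Fin using (Fin)
open import Data.Fin.Properties using (_≟_)
open import Data.Bool using (Bool; true; false; if_then_else_)
open import Data.List using (List; []; _∷_; _++_; _∷ʳ_; map; foldr; length; allFin)
open import Data.List.Relation.Unary.Linked using (Linked)
open import Data.List.Relation.Unary.All using (All)
open import Data.List.Relation.Binary.Infix.Heterogeneous using (Infix)
open import Data.List.Relation.Binary.Infix.Heterogeneous.Properties using (infix?)
open import Data.List.Relation.Binary.Suffix.Heterogeneous using (Suffix)
open import Data.Product using (Σ; ∃; _×_; _,_; proj₁; proj₂)
open import Data.Sum using (_⊎_)
open import Relation.Nullary using (¬_; Dec; yes; no)
open import Relation.Binary.PropositionalEquality using (_≡_; _≢_)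
open import Relation.Binary.Structures using (IsStrictTotalOrder)
open import Algebra.Structures using (IsCommutativeRing)

-- Ordered fields (the stdlib has no reals).  The flow values and the
-- weights of decompositions live in an arbitrary ordered field; the
-- paper's setting is the instance F = ℝ.

record OrderedField : Set₁ where
  infixl 6 _+_
  infixl 7 _*_
  infix 4 _<_ _≤_
  field
    Carrier : Set
    _+_ _*_ : Carrier → Carrier → Carrier
    -_      : Carrier → Carrier
    0# 1#   : Carrier
    isCommutativeRing  : IsCommutativeRing _≡_ _+_ _*_ -_ 0# 1#
    _<_                : Carrier → Carrier → Set
    isStrictTotalOrder : IsStrictTotalOrder _≡_ _<_
    +-mono-<  : ∀ {a b} c → a < b → a + c < b + c
    *-pos     : ∀ {a b} → 0# < a → 0# < b → 0# < a * b
    0<1       : 0# < 1#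
    inverse   : ∀ a → a ≢ 0# → Σ Carrier (λ b → a * b ≡ 1#)

  _≤_ : Carrier → Carrier → Set
  a ≤ b = a < b ⊎ a ≡ b

  sum : List Carrier → Carrier
  sum = foldr _+_ 0#

-- Directed graphs on the vertex set Fin n.  The edge set is given by a
-- Boolean adjacency relation, so there are no parallel edges.

module Graph {n : ℕ} (E : Fin n → Fin n → Bool) where

  Edge : Fin n → Fin n → Set
  Edge a b = E a b ≡ true

  IsPath : List (Fin n) → Set
  IsPath xs = length xs ≥ 2 × Linked Edge xs

  Acyclic : Set
  Acyclic = ∀ (v : Fin n) (xs : List (Fin n)) → ¬ IsPath ((v ∷ xs) ∷ʳ v)

  SubpathOf : List (Fin n) → List (Fin n) → Set
  SubpathOf Q P = Infix _≡_ Q P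

  subpathOf? : ∀ Q P → Dec (SubpathOf Q P)
  subpathOf? = infix? _≟_

  SuffixOf : List (Fin n) → List (Fin n) → Set
  SuffixOf P Q = Suffix _≡_ P Q

  LastEdge : List (Fin n) → Fin n → Fin n → Set
  LastEdge P u v = Σ (List (Fin n)) (λ xs → P ≡ xs ++ (u ∷ v ∷ []))

module Flow (F : OrderedField) {n : ℕ} (E : Fin n → Fin n → Bool)
            (f : Fin n → Fin n → OrderedField.Carrier F) where
  open OrderedField F
  open Graph E

  fE : Fin n → Fin n → Carrier
  fE a b = if E a b then f a b else 0#

  f-in : Fin n → Carrier
  f-in u = sum (map (λ w → fE w u) (allFin n))

  f-out : Fin n → Carrier
  f-out u = sum (map (λ w → fE u w) (allFin n))

  IsSource : Fin n → Set
  IsSource u = f-in u ≡ 0#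

  IsSink : Fin n → Set
  IsSink u = f-out u ≡ 0#

  IsFlowGraph : Set
  IsFlowGraph =
      Acyclic
    × (∀ a b → Edge a b → 0# ≤ f a b)
    × (∀ u → ¬ IsSource u → ¬ IsSink u → f-in u ≡ f-out u)

  IsSTPath : List (Fin n) → Set
  IsSTPath [] = IsPath []
  IsSTPath (s ∷ xs) =
    IsPath (s ∷ xs) × IsSource s × Σ (List (Fin n)) (λ ys → Σ (Fin n) (λ t → s ∷ xs ≡ ys ∷ʳ t × IsSink t))

  weightThrough : List (List (Fin n) × Carrier) → List (Fin n) → Carrier
  weightThrough [] Q = 0#
  weightThrough ((P , w) ∷ D) Q with subpathOf? Q P
  ... | yes _ = w + weightThrough D Q
  ... | no  _ = weightThrough D Q

  IsFlowDecomposition : List (List (Fin n) × Carrier) → Set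
  IsFlowDecomposition D =
      All (λ Pw → IsSTPath (proj₁ Pw) × 0# < proj₂ Pw) D
    × (∀ a b → Edge a b → weightThrough D (a ∷ b ∷ []) ≡ f a b)

  WSafe : Carrier → List (Fin n) → Set
  WSafe w P = IsPath P × (∀ D → IsFlowDecomposition D → w ≤ weightThrough D P)

  Safe : List (Fin n) → Set
  Safe P = Σ Carrier (λ w → 0# < w × WSafe w P)

  UniqueMaxOut : Fin n → Fin n → Set
  UniqueMaxOut u v = Edge u v × (∀ w → Edge u w → w ≢ v → f u w < f u v)

{-# OPTIONS --safe #-}

-- Suppose two safe paths with last edge (u , v) are not suffixes of one another: they end with a common
-- chain K, u, v but enter K from different vertices a ≢ b.  Build a flow decomposition in the usual way,
-- starting from the single edges and splicing incoming with outgoing paths proportionally at each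
-- internal vertex, but treat u last.  At u the outgoing paths through v carry f(u,v), and some other edge
-- (u , w′) has f(u,w′) ≥ f(u,v), so the remaining outgoing paths carry at least half of the flow through u.
-- The incoming paths arriving via a, K and via b, K are disjoint, so one of these two families fits into
-- the remaining outgoing paths; splicing it only with them gives a flow decomposition in which no path
-- contains that chain followed by (u , v), contradicting safety.

module Submission where

open import Level using (0ℓ)
open import Function using (_∘_; id)
open import Algebra.Bundles using (CommutativeRing)
open import Relation.Binary.Core using (Rel)
open import Relation.Binary.Structures using (IsStrictTotalOrder)
open import Relation.Binary.Definitions using (tri<; tri≈; tri>)
import Relation.Binary.Construct.StrictToNonStrict as StrictToNonStrict
open import Relation.Binary.PropositionalEquality
open import Relation.Nullary using (¬_; Dec; yes; no; ¬?; _×-dec_)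
open import Relation.Nullary.Decidable using (map′; _→-dec_; decidable-stable)
open import Relation.Unary using (Pred; Decidable)
open import Data.Empty using (⊥; ⊥-elim)
open import Data.Sum using (_⊎_; inj₁; inj₂; [_,_]′) renaming (map₁ to ⊎-map₁)
open import Data.Product using (Σ; ∃; ∃₂; _×_; _,_; proj₁; proj₂)
open import Data.Nat using (ℕ; s≤s; z≤n)
import Data.Nat as ℕ
import Data.Nat.Properties as ℕₚ
open import Data.Bool using (Bool; true; false)
import Data.Bool.Properties as Bool
open import Data.Fin using (Fin; zero; suc)
open import Data.Fin.Properties using (_≟_; suc-injective; ¬∀⟶∃¬)
open import Data.List
  using (List; []; _∷_; _++_; _∷ʳ_; length; reverse; map; filter; concatMap; drop; allFin; tabulate; initLast; _∷ʳ′_)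
open import Data.List.Properties
  using ( map-tabulate; length-++; ++-assoc; ∷-injective; ∷ʳ-++; ∷ʳ-injective; ++-identityʳ; ++-cancelʳ; ++-conicalʳ
        ; reverse-++; reverse-involutive; unfold-reverse)
open import Data.List.Membership.Propositional using (_∈_; _∉_)
open import Data.List.Membership.Propositional.Properties using (∈-∃++; ∈-++⁺ʳ; ∈-++⁻; ∈-filter⁺; ∈-filter⁻; ∈-allFin)
open import Data.List.Relation.Unary.Any using (here; there)
open import Data.List.Relation.Unary.All as All using (All; []; _∷_)
import Data.List.Relation.Unary.All.Properties as All
open import Data.List.Relation.Unary.AllPairs using (_∷_)
open import Data.List.Relation.Unary.Linked using (Linked; []; [-]; _∷_)
open import Data.List.Relation.Unary.Unique.Propositional using (Unique)
import Data.List.Relation.Unary.Unique.Propositional.Properties as Unique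
open import Data.List.Relation.Binary.Pointwise using (Pointwise-≡⇒≡; ≡⇒Pointwise-≡)
open import Data.List.Relation.Binary.Prefix.Heterogeneous using (Prefix; []; _∷_)
open import Data.List.Relation.Binary.Infix.Heterogeneous using (Infix; here; there; MkView)
import Data.List.Relation.Binary.Infix.Heterogeneous as Infix
import Data.List.Relation.Binary.Infix.Heterogeneous.Properties as Infix
open import Data.List.Relation.Binary.Suffix.Heterogeneous using (Suffix)
import Data.List.Relation.Binary.Suffix.Heterogeneous as Suffix
import Data.List.Relation.Binary.Suffix.Heterogeneous.Properties as Suffix
open import Defs

private
  variable
    A B : Set

module OrderedFieldProperties (F : OrderedField) where
  open OrderedField F public
  open IsStrictTotalOrder isStrictTotalOrder public
    using (compare; _<?_) renaming (irrefl to <-irrefl′; trans to <-trans; _≟_ to _≈?_)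

  commutativeRing : CommutativeRing 0ℓ 0ℓ
  commutativeRing = record
    { Carrier = Carrier ; _≈_ = _≡_ ; _+_ = _+_ ; _*_ = _*_ ; -_ = -_
    ; 0# = 0# ; 1# = 1# ; isCommutativeRing = isCommutativeRing }

  open CommutativeRing commutativeRing public
    using ( +-comm; +-assoc; *-comm; +-identityˡ; +-identityʳ; *-identityˡ; *-identityʳ
          ; distribˡ; distribʳ; -‿inverseˡ; -‿inverseʳ; zeroˡ; zeroʳ; commutativeSemiring)
  open import Algebra.Properties.Ring (CommutativeRing.ring commutativeRing)
    using (-‿distribˡ-*; -‿distribʳ-*)
  open import Algebra.Solver.Ring.NaturalCoefficients.Default commutativeSemiring public
    using (solve; _:=_; _:+_; _:*_; con)

  infixl 6 _-_
  _-_ : Carrier → Carrier → Carrier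
  a - b = a + - b

  -+-cancel : ∀ a b → (b - a) + a ≡ b
  -+-cancel a b = trans (+-assoc b (- a) a) (trans (cong (b +_) (-‿inverseˡ a)) (+-identityʳ b))

  +--cancel : ∀ a b → (b + a) - a ≡ b
  +--cancel a b = trans (+-assoc b a (- a)) (trans (cong (b +_) (-‿inverseʳ a)) (+-identityʳ b))

  +-cancelʳ : ∀ {x y} a → x + a ≡ y + a → x ≡ y
  +-cancelʳ {x} {y} a e = trans (sym (+--cancel a x)) (trans (cong (_- a) e) (+--cancel a y))

  private module NonStrict = StrictToNonStrict _≡_ _<_

  <-irrefl : ∀ {a} → ¬ (a < a)
  <-irrefl = <-irrefl′ refl

  <⇒≢ : ∀ {a b} → a < b → a ≢ b
  <⇒≢ p refl = <-irrefl p

  ≤-refl : ∀ {a} → a ≤ a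
  ≤-refl = inj₂ refl

  ≤-reflexive : ∀ {a b} → a ≡ b → a ≤ b
  ≤-reflexive = inj₂

  ≤-trans : ∀ {a b c} → a ≤ b → b ≤ c → a ≤ c
  ≤-trans = NonStrict.trans isEquivalence (resp₂ _<_) <-trans

  <-≤-trans : ∀ {a b c} → a < b → b ≤ c → a < c
  <-≤-trans = NonStrict.<-≤-trans <-trans (respʳ _<_)

  ≤-<-trans : ∀ {a b c} → a ≤ b → b < c → a < c
  ≤-<-trans = NonStrict.≤-<-trans sym <-trans (respˡ _<_)

  ≤-antisym : ∀ {a b} → a ≤ b → b ≤ a → a ≡ b
  ≤-antisym = NonStrict.antisym isEquivalence <-trans <-irrefl′

  ≤⇒≯ : ∀ {a b} → a ≤ b → ¬ (b < a)
  ≤⇒≯ p q = <-irrefl (≤-<-trans p q)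

  ≮⇒≥ : ∀ {a b} → ¬ (a < b) → b ≤ a
  ≮⇒≥ {a} {b} a≮b with compare a b
  ... | tri< a<b _ _ = ⊥-elim (a≮b a<b)
  ... | tri≈ _ a≡b _ = inj₂ (sym a≡b)
  ... | tri> _ _ b<a = inj₁ b<a

  0≤∧≢0⇒0< : ∀ {a} → 0# ≤ a → a ≢ 0# → 0# < a
  0≤∧≢0⇒0< (inj₁ p) _  = p
  0≤∧≢0⇒0< (inj₂ e) ne = ⊥-elim (ne (sym e))

  +-monoʳ-< : ∀ {a b} c → a < b → c + a < c + b
  +-monoʳ-< {a} {b} c p = subst₂ _<_ (+-comm a c) (+-comm b c) (+-mono-< c p)

  +-monoˡ-≤ : ∀ {a b} c → a ≤ b → a + c ≤ b + c
  +-monoˡ-≤ c (inj₁ p)    = inj₁ (+-mono-< c p)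
  +-monoˡ-≤ c (inj₂ refl) = ≤-refl

  +-monoʳ-≤ : ∀ {a b} c → a ≤ b → c + a ≤ c + b
  +-monoʳ-≤ c (inj₁ p)    = inj₁ (+-monoʳ-< c p)
  +-monoʳ-≤ c (inj₂ refl) = ≤-refl

  +-mono-≤ : ∀ {a b c d} → a ≤ b → c ≤ d → a + c ≤ b + d
  +-mono-≤ {b = b} {c = c} p q = ≤-trans (+-monoˡ-≤ c p) (+-monoʳ-≤ b q)

  +-mono-<-≤ : ∀ {a b c d} → a < b → c ≤ d → a + c < b + d
  +-mono-<-≤ {b = b} {c = c} p q = <-≤-trans (+-mono-< c p) (+-monoʳ-≤ b q)

  +-nonneg : ∀ {a b} → 0# ≤ a → 0# ≤ b → 0# ≤ a + b
  +-nonneg p q = subst (_≤ _) (+-identityʳ 0#) (+-mono-≤ p q)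

  <⇒0<- : ∀ {a b} → a < b → 0# < b - a
  <⇒0<- {a} {b} p = subst (_< b - a) (-‿inverseʳ a) (+-mono-< (- a) p)

  0<-⇒< : ∀ {a b} → 0# < b - a → a < b
  0<-⇒< {a} {b} p = subst₂ _<_ (+-identityˡ a) (-+-cancel a b) (+-mono-< a p)

  ≤⇒0≤- : ∀ {a b} → a ≤ b → 0# ≤ b - a
  ≤⇒0≤- (inj₁ p)        = inj₁ (<⇒0<- p)
  ≤⇒0≤- {a} (inj₂ refl) = inj₂ (sym (-‿inverseʳ a))

  *-monoˡ-< : ∀ {a b c} → 0# < c → a < b → a * c < b * c
  *-monoˡ-< {a} {b} {c} 0<c a<b = 0<-⇒< (subst (0# <_) distrib (*-pos (<⇒0<- a<b) 0<c))
    where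
    distrib : (b - a) * c ≡ b * c - a * c
    distrib = trans (distribʳ c b (- a)) (cong (b * c +_) (sym (-‿distribˡ-* a c)))

  *-monoˡ-≤ : ∀ {a b c} → 0# ≤ c → a ≤ b → a * c ≤ b * c
  *-monoˡ-≤ (inj₁ 0<c) (inj₁ a<b)      = inj₁ (*-monoˡ-< 0<c a<b)
  *-monoˡ-≤ {a} {b} (inj₂ refl) (inj₁ _) = inj₂ (trans (zeroʳ a) (sym (zeroʳ b)))
  *-monoˡ-≤ _ (inj₂ refl)               = ≤-refl

  *-nonneg : ∀ {a b} → 0# ≤ a → 0# ≤ b → 0# ≤ a * b
  *-nonneg {a} {b} p q = subst (_≤ a * b) (zeroˡ b) (*-monoˡ-≤ q p)

  -- The inverse of a positive element is positive: otherwise a * (- b) = - 1# would be positive.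
  inverse-pos : ∀ {a b} → 0# < a → a * b ≡ 1# → 0# < b
  inverse-pos {a} {b} 0<a ab≡1 with compare 0# b
  ... | tri< 0<b _ _ = 0<b
  ... | tri≈ _ refl _ = ⊥-elim (<⇒≢ 0<1 (trans (sym (zeroʳ a)) ab≡1))
  ... | tri> _ _ b<0 = ⊥-elim (<-irrefl (subst₂ _<_ (+-identityʳ 0#) (-‿inverseʳ 1#) (+-mono-<-≤ 0<1 (inj₁ 0<-1))))
    where
    0<-1 : 0# < - 1#
    0<-1 = subst (0# <_) (trans (sym (-‿distribʳ-* a b)) (cong -_ ab≡1))
                 (*-pos 0<a (subst (0# <_) (+-identityˡ (- b)) (<⇒0<- b<0)))

  ∑ : (A → Carrier) → List A → Carrier
  ∑ h []       = 0#
  ∑ h (x ∷ xs) = h x + ∑ h xs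

  sum-map : ∀ (h : A → Carrier) xs → sum (map h xs) ≡ ∑ h xs
  sum-map h []       = refl
  sum-map h (x ∷ xs) = cong (h x +_) (sum-map h xs)

  when : {P : Set} → Dec P → Carrier → Carrier
  when (yes _) w = w
  when (no _)  _ = 0#

  when-yes : {P : Set} (d : Dec P) → P → ∀ w → when d w ≡ w
  when-yes (yes _) _ w = refl
  when-yes (no ¬p) p w = ⊥-elim (¬p p)

  when-no : {P : Set} (d : Dec P) → ¬ P → ∀ w → when d w ≡ 0#
  when-no (yes p) ¬p w = ⊥-elim (¬p p)
  when-no (no _)  _  w = refl

  when-disjoint : {P Q : Set} (d₁ : Dec P) (d₂ : Dec Q) {w : Carrier} → 0# ≤ w → (P → Q → ⊥) →
                  when d₁ w + when d₂ w ≤ w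
  when-disjoint (yes p) (yes q) _   p∧q⇒⊥ = ⊥-elim (p∧q⇒⊥ p q)
  when-disjoint (yes _) (no _)  _   _     = ≤-reflexive (+-identityʳ _)
  when-disjoint (no _)  (yes _) _   _     = ≤-reflexive (+-identityˡ _)
  when-disjoint (no _)  (no _)  0≤w _     = subst (_≤ _) (sym (+-identityˡ 0#)) 0≤w

  when-0 : {P : Set} (d : Dec P) → when d 0# ≡ 0#
  when-0 (yes _) = refl
  when-0 (no _)  = refl

  when-≡-* : {P : Set} (d : Dec P) (w : Carrier) → when d w ≡ when d 1# * w
  when-≡-* (yes _) w = sym (*-identityˡ w)
  when-≡-* (no _)  w = sym (zeroˡ w)

  when-≤ : {P : Set} (d : Dec P) {w : Carrier} → 0# ≤ w → when d w ≤ w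
  when-≤ (yes _) _ = ≤-refl
  when-≤ (no _)  p = p

  when-nonneg : {P : Set} (d : Dec P) {w : Carrier} → 0# ≤ w → 0# ≤ when d w
  when-nonneg (yes _) p = p
  when-nonneg (no _)  _ = ≤-refl

  ∑-≗ : ∀ {h g : A → Carrier} → (∀ x → h x ≡ g x) → ∀ xs → ∑ h xs ≡ ∑ g xs
  ∑-≗ e []       = refl
  ∑-≗ e (x ∷ xs) = cong₂ _+_ (e x) (∑-≗ e xs)

  ∑-cong : ∀ {h g : A → Carrier} {xs} → All (λ x → h x ≡ g x) xs → ∑ h xs ≡ ∑ g xs
  ∑-cong []       = refl
  ∑-cong (e ∷ es) = cong₂ _+_ e (∑-cong es)

  ∑-zero : ∀ {h : A → Carrier} {xs} → All (λ x → h x ≡ 0#) xs → ∑ h xs ≡ 0#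
  ∑-zero []       = refl
  ∑-zero (e ∷ es) = trans (cong₂ _+_ e (∑-zero es)) (+-identityʳ 0#)

  ∑-++ : ∀ (h : A → Carrier) xs ys → ∑ h (xs ++ ys) ≡ ∑ h xs + ∑ h ys
  ∑-++ h []       ys = sym (+-identityˡ _)
  ∑-++ h (x ∷ xs) ys = trans (cong (h x +_) (∑-++ h xs ys)) (sym (+-assoc _ _ _))

  ∑-+ : ∀ (h g : A → Carrier) xs → ∑ (λ x → h x + g x) xs ≡ ∑ h xs + ∑ g xs
  ∑-+ h g []       = sym (+-identityˡ 0#)
  ∑-+ h g (x ∷ xs) = trans (cong (h x + g x +_) (∑-+ h g xs)) (interchange (h x) (g x) (∑ h xs) (∑ g xs))
    where
    interchange : ∀ a b c d → (a + b) + (c + d) ≡ (a + c) + (b + d)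
    interchange = solve 4 (λ a b c d → (a :+ b) :+ (c :+ d) := (a :+ c) :+ (b :+ d)) refl

  ∑-*ˡ : ∀ c (h : A → Carrier) xs → ∑ (λ x → c * h x) xs ≡ c * ∑ h xs
  ∑-*ˡ c h []       = sym (zeroʳ c)
  ∑-*ˡ c h (x ∷ xs) = trans (cong (c * h x +_) (∑-*ˡ c h xs)) (sym (distribˡ c (h x) (∑ h xs)))

  ∑-mono : ∀ {h g : A → Carrier} {xs} → All (λ x → h x ≤ g x) xs → ∑ h xs ≤ ∑ g xs
  ∑-mono []       = ≤-refl
  ∑-mono (e ∷ es) = +-mono-≤ e (∑-mono es)

  ∑-nonneg : ∀ {h : A → Carrier} {xs} → All (λ x → 0# ≤ h x) xs → 0# ≤ ∑ h xs
  ∑-nonneg []       = ≤-refl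
  ∑-nonneg (e ∷ es) = +-nonneg e (∑-nonneg es)

  ∑-∈ : ∀ {h : A → Carrier} {x xs} → x ∈ xs → All (λ x → 0# ≤ h x) xs → h x ≤ ∑ h xs
  ∑-∈ {h = h} {x = x} {xs = _ ∷ ys} (here refl) (_ ∷ ps) =
    subst (_≤ h x + ∑ h ys) (+-identityʳ (h x)) (+-monoʳ-≤ (h x) (∑-nonneg ps))
  ∑-∈ {h = h} {x = x} {xs = y ∷ ys} (there m) (p ∷ ps) =
    subst (_≤ h y + ∑ h ys) (+-identityˡ (h x)) (+-mono-≤ p (∑-∈ m ps))

  ∑-filter : ∀ {P : Pred A 0ℓ} (P? : Decidable P) (h : A → Carrier) xs →
             ∑ h (filter P? xs) ≡ ∑ (λ x → when (P? x) (h x)) xs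
  ∑-filter P? h []       = refl
  ∑-filter P? h (x ∷ xs) with P? x
  ... | yes _ = cong (h x +_) (∑-filter P? h xs)
  ... | no _  = trans (∑-filter P? h xs) (sym (+-identityˡ _))

  ∑-partition : ∀ {P : Pred A 0ℓ} (P? : Decidable P) (h : A → Carrier) xs →
                ∑ h xs ≡ ∑ h (filter P? xs) + ∑ h (filter (¬? ∘ P?) xs)
  ∑-partition P? h []       = sym (+-identityˡ _)
  ∑-partition P? h (x ∷ xs) with P? x
  ... | yes _ = trans (cong (h x +_) (∑-partition P? h xs)) (sym (+-assoc (h x) _ _))
  ... | no _  = trans (cong (h x +_) (∑-partition P? h xs)) (left-comm (h x) _ _)
    where
    left-comm : ∀ a b c → a + (b + c) ≡ b + (a + c)
    left-comm = solve 3 (λ a b c → a :+ (b :+ c) := b :+ (a :+ c)) refl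

  ∑-map : ∀ (h : B → Carrier) (g : A → B) xs → ∑ h (map g xs) ≡ ∑ (h ∘ g) xs
  ∑-map h g []       = refl
  ∑-map h g (x ∷ xs) = cong (h (g x) +_) (∑-map h g xs)

  ∑-concatMap : ∀ (h : B → Carrier) (g : A → List B) xs → ∑ h (concatMap g xs) ≡ ∑ (∑ h ∘ g) xs
  ∑-concatMap h g []       = refl
  ∑-concatMap h g (x ∷ xs) = trans (∑-++ h (g x) (concatMap g xs)) (cong (∑ h (g x) +_) (∑-concatMap h g xs))

  ∑-comm : ∀ (h : A → B → Carrier) xs ys →
           ∑ (λ x → ∑ (h x) ys) xs ≡ ∑ (λ y → ∑ (λ x → h x y) xs) ys
  ∑-comm h []       ys = sym (∑-zero {xs = ys} (All.tabulate (λ _ → refl)))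
  ∑-comm h (x ∷ xs) ys =
    trans (cong (∑ (h x) ys +_) (∑-comm h xs ys)) (sym (∑-+ (h x) (λ y → ∑ (λ x → h x y) xs) ys))

  ∑-tabulate-suc : ∀ n (g : Fin (ℕ.suc n) → Carrier) → ∑ g (tabulate suc) ≡ ∑ (g ∘ suc) (allFin n)
  ∑-tabulate-suc n g = begin
    ∑ g (tabulate suc)                 ≡⟨ sym (sum-map g (tabulate suc)) ⟩
    sum (map g (tabulate suc))         ≡⟨ cong sum (trans (map-tabulate suc g) (sym (map-tabulate id (g ∘ suc)))) ⟩
    sum (map (g ∘ suc) (tabulate id))  ≡⟨ sum-map (g ∘ suc) (allFin n) ⟩
    ∑ (g ∘ suc) (allFin n)             ∎
    where open ≡-Reasoning

  ∑-allFin-single : ∀ n (g : Fin n → Carrier) i → (∀ j → j ≢ i → g j ≡ 0#) → ∑ g (allFin n) ≡ g i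
  ∑-allFin-single (ℕ.suc n) g zero g≡0 =
    trans (cong (g zero +_) (trans (∑-tabulate-suc n g) (∑-zero {xs = allFin n} (All.tabulate (λ {j} _ → g≡0 (suc j) λ ())))))
          (+-identityʳ _)
  ∑-allFin-single (ℕ.suc n) g (suc i) g≡0 =
    trans (cong₂ _+_ (g≡0 zero λ ())
                     (trans (∑-tabulate-suc n g)
                            (∑-allFin-single n (g ∘ suc) i (λ j j≢i → g≡0 (suc j) (j≢i ∘ suc-injective)))))
          (+-identityˡ _)

  -- Inverse, with the junk value 0⁻¹ = 0

  _⁻¹ : Carrier → Carrier
  a ⁻¹ with a ≈? 0#
  ... | yes _  = 0#
  ... | no a≢0 = proj₁ (inverse a a≢0)

  *-inverseʳ : ∀ {a} → a ≢ 0# → a * a ⁻¹ ≡ 1#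
  *-inverseʳ {a} a≢0 with a ≈? 0#
  ... | yes a≡0 = ⊥-elim (a≢0 a≡0)
  ... | no a≢0′ = proj₂ (inverse a a≢0′)

  0⁻¹≡0 : 0# ⁻¹ ≡ 0#
  0⁻¹≡0 with 0# ≈? 0#
  ... | yes _   = refl
  ... | no 0≢0 = ⊥-elim (0≢0 refl)

  ⁻¹-pos : ∀ {a} → 0# < a → 0# < a ⁻¹
  ⁻¹-pos {a} 0<a = inverse-pos 0<a (*-inverseʳ (<⇒≢ 0<a ∘ sym))

  ⁻¹-nonneg : ∀ {a} → 0# ≤ a → 0# ≤ a ⁻¹
  ⁻¹-nonneg (inj₁ 0<a)  = inj₁ (⁻¹-pos 0<a)
  ⁻¹-nonneg (inj₂ refl) = inj₂ (sym 0⁻¹≡0)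

infix⇒++ : ∀ {ys xs : List A} → Infix _≡_ ys xs → ∃₂ λ X Y → xs ≡ X ++ ys ++ Y
infix⇒++ i with MkView X p Y ← Infix.toView i with refl ← Pointwise-≡⇒≡ p = X , Y , refl

++⇒infix : ∀ X (ys : List A) Y {xs} → xs ≡ X ++ ys ++ Y → Infix _≡_ ys xs
++⇒infix X ys Y refl = Infix.fromView (MkView X (≡⇒Pointwise-≡ refl) Y)

infix-++ʳ : ∀ X (ys : List A) → Infix _≡_ ys (X ++ ys)
infix-++ʳ X ys = ++⇒infix X ys [] (cong (X ++_) (sym (++-identityʳ ys)))

infix-trans : ∀ {xs ys zs : List A} → Infix _≡_ xs ys → Infix _≡_ ys zs → Infix _≡_ xs zs
infix-trans = Infix.trans trans

infix⇒∈ : ∀ {x : A} {ys xs} → Infix _≡_ (x ∷ ys) xs → x ∈ xs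
infix⇒∈ (here (refl ∷ _)) = here refl
infix⇒∈ (there i)         = there (infix⇒∈ i)

suffix⇒++ : ∀ {ys xs : List A} → Suffix _≡_ ys xs → ∃ λ X → xs ≡ X ++ ys
suffix⇒++ s with X Suffix.++ p ← Suffix.toView s with refl ← Pointwise-≡⇒≡ p = X , refl

++⇒suffix : ∀ X (ys : List A) → Suffix _≡_ ys (X ++ ys)
++⇒suffix X ys = Suffix.fromView (X Suffix.++ ≡⇒Pointwise-≡ refl)

suffix-∷-unique : ∀ {a b : A} K {P} → Suffix _≡_ (a ∷ K) P → Suffix _≡_ (b ∷ K) P → a ≡ b
suffix-∷-unique {a = a} {b = b} K s₁ s₂ with X₁ , e₁ ← suffix⇒++ s₁ | X₂ , e₂ ← suffix⇒++ s₂ =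
  proj₂ (∷ʳ-injective X₁ X₂ (++-cancelʳ K (X₁ ∷ʳ a) (X₂ ∷ʳ b)
    (trans (∷ʳ-++ X₁ a K) (trans (sym e₁) (trans e₂ (sym (∷ʳ-++ X₂ b K)))))))

++-overlap : ∀ (X Z P Q : List A) → X ++ Z ≡ P ++ Q →
             (∃ λ M → P ≡ X ++ M × Z ≡ M ++ Q) ⊎ (∃ λ M → X ≡ P ++ M × Q ≡ M ++ Z)
++-overlap []      Z P       Q e = inj₁ (P , refl , e)
++-overlap (x ∷ X) Z []      Q e = inj₂ (x ∷ X , refl , sym e)
++-overlap (x ∷ X) Z (p ∷ P) Q e with refl , e′ ← ∷-injective e with ++-overlap X Z P Q e′
... | inj₁ (M , refl , e″) = inj₁ (M , refl , e″)
... | inj₂ (M , refl , e″) = inj₂ (M , refl , e″)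

All-concatMap : ∀ {B : Set} {Q : B → Set} (g : A → List B) {xs} → All (λ x → All Q (g x)) xs → All Q (concatMap g xs)
All-concatMap g []       = []
All-concatMap g (q ∷ qs) = All.++⁺ q (All-concatMap g qs)

module _ {c d : A} where

  splice-pair⁻ : ∀ p′ y s′ → Infix _≡_ (c ∷ d ∷ []) (p′ ++ y ∷ s′) →
                 Infix _≡_ (c ∷ d ∷ []) (p′ ∷ʳ y) ⊎ Infix _≡_ (c ∷ d ∷ []) (y ∷ s′)
  splice-pair⁻ []           y s′ i                         = inj₂ i
  splice-pair⁻ (x ∷ [])     y s′ (here (refl ∷ refl ∷ [])) = inj₁ (here (refl ∷ refl ∷ []))
  splice-pair⁻ (x ∷ z ∷ p′) y s′ (here (refl ∷ refl ∷ [])) = inj₁ (here (refl ∷ refl ∷ []))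
  splice-pair⁻ (x ∷ p′)     y s′ (there i)                 = ⊎-map₁ there (splice-pair⁻ p′ y s′ i)

  pair-∷ʳ⇒∈ : ∀ p′ {y} → Infix _≡_ (c ∷ d ∷ []) (p′ ∷ʳ y) → c ∈ p′
  pair-∷ʳ⇒∈ []       (here (_ ∷ ()))
  pair-∷ʳ⇒∈ []       (there (here ()))
  pair-∷ʳ⇒∈ (x ∷ p′) (here (refl ∷ _)) = here refl
  pair-∷ʳ⇒∈ (x ∷ p′) (there i)         = there (pair-∷ʳ⇒∈ p′ i)

splice-infixˡ : ∀ p′ (y : A) s′ {q} → Infix _≡_ q (p′ ∷ʳ y) → Infix _≡_ q (p′ ++ y ∷ s′)
splice-infixˡ p′ y s′ i = infix-trans i (++⇒infix [] (p′ ∷ʳ y) s′ (sym (∷ʳ-++ p′ y s′)))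

splice-infixʳ : ∀ p′ (y : A) s′ {q} → Infix _≡_ q (y ∷ s′) → Infix _≡_ q (p′ ++ y ∷ s′)
splice-infixʳ p′ y s′ i = infix-trans i (infix-++ʳ p′ (y ∷ s′))

module _ {R : Rel A 0ℓ} where

  Linked-++⁻ˡ : ∀ (xs : List A) {ys} → Linked R (xs ++ ys) → Linked R xs
  Linked-++⁻ˡ []           _       = []
  Linked-++⁻ˡ (x ∷ [])     _       = [-]
  Linked-++⁻ˡ (x ∷ y ∷ xs) (r ∷ l) = r ∷ Linked-++⁻ˡ (y ∷ xs) l

  Linked-++⁻ʳ : ∀ (xs : List A) {ys} → Linked R (xs ++ ys) → Linked R ys
  Linked-++⁻ʳ []           l       = l
  Linked-++⁻ʳ (x ∷ [])     [-]     = []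
  Linked-++⁻ʳ (x ∷ [])     (r ∷ l) = l
  Linked-++⁻ʳ (x ∷ y ∷ xs) (r ∷ l) = Linked-++⁻ʳ (y ∷ xs) l

  Linked-splice : ∀ (xs : List A) {y ys} → Linked R (xs ∷ʳ y) → Linked R (y ∷ ys) → Linked R (xs ++ y ∷ ys)
  Linked-splice []            _       l = l
  Linked-splice (x ∷ [])      (r ∷ _) l = r ∷ l
  Linked-splice (x ∷ x′ ∷ xs) (r ∷ l′) l = r ∷ Linked-splice (x′ ∷ xs) l′ l

  Linked-pair : ∀ (X : List A) {c d Y} → Linked R (X ++ c ∷ d ∷ Y) → R c d
  Linked-pair X l with r ∷ _ ← Linked-++⁻ʳ X l = r

  Linked-infix : ∀ {xs c d} → Linked R xs → Infix _≡_ (c ∷ d ∷ []) xs → R c d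
  Linked-infix l i with X , _ , refl ← infix⇒++ i = Linked-pair X l

StartsWith : A → List A → Set
StartsWith y P = ∃ λ Q → P ≡ y ∷ Q

EndsWith : A → List A → Set
EndsWith y P = ∃ λ R → P ≡ R ∷ʳ y

startsWith⇒∈ : ∀ {y : A} {P} → StartsWith y P → y ∈ P
startsWith⇒∈ (_ , refl) = here refl

endsWith⇒∈ : ∀ {y : A} {P} → EndsWith y P → y ∈ P
endsWith⇒∈ (R , refl) = ∈-++⁺ʳ R (here refl)

startsWith-unique : ∀ {y z : A} {P} → StartsWith y P → StartsWith z P → y ≡ z
startsWith-unique (_ , refl) (_ , refl) = refl

endsWith-unique : ∀ {y z : A} {P} → EndsWith y P → EndsWith z P → y ≡ z
endsWith-unique (R₁ , refl) (R₂ , e) = proj₂ (∷ʳ-injective R₁ R₂ e)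

startsWith-++⁺ : ∀ {y : A} {P} Q → StartsWith y P → StartsWith y (P ++ Q)
startsWith-++⁺ Q (P′ , refl) = P′ ++ Q , refl

startsWith-++⁻ : ∀ {y : A} P {Q} → P ≢ [] → StartsWith y (P ++ Q) → StartsWith y P
startsWith-++⁻ []      P≢[] _          = ⊥-elim (P≢[] refl)
startsWith-++⁻ (x ∷ P) _    (_ , refl) = P , refl

endsWith-++⁺ : ∀ {y : A} P {Q} → EndsWith y Q → EndsWith y (P ++ Q)
endsWith-++⁺ P (R , refl) = P ++ R , sym (++-assoc P R _)

endsWith-++⁻ : ∀ {y : A} P {Q} → Q ≢ [] → EndsWith y (P ++ Q) → EndsWith y Q
endsWith-++⁻ P {Q} Q≢[] (R , e) with ++-overlap P Q R _ e
... | inj₁ (M , _ , Q≡M∷ʳy)      = M , Q≡M∷ʳy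
... | inj₂ ([] , _ , y∷[]≡Q)     = [] , sym y∷[]≡Q
... | inj₂ (m ∷ M , _ , y∷[]≡mMQ) = ⊥-elim (Q≢[] (++-conicalʳ M Q (sym (proj₂ (∷-injective y∷[]≡mMQ)))))

nonempty⇒endsWith : ∀ (P : List A) → P ≢ [] → ∃ λ t → EndsWith t P
nonempty⇒endsWith P P≢[] with initLast P
... | []       = ⊥-elim (P≢[] refl)
... | R ∷ʳ′ t = t , R , refl

Diverge : List A → List A → Set
Diverge xs ys = ∃ λ K → ∃₂ λ a b → ∃₂ λ R₁ R₂ → a ≢ b × xs ≡ R₁ ++ a ∷ K × ys ≡ R₂ ++ b ∷ K

module _ (_≟A_ : (a b : A) → Dec (a ≡ b)) where

  startsWith? : ∀ y P → Dec (StartsWith y P)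
  startsWith? y []      = no λ ()
  startsWith? y (x ∷ P) with x ≟A y
  ... | yes refl = yes (P , refl)
  ... | no x≢y   = no λ { (_ , refl) → x≢y refl }

  endsWith? : ∀ y P → Dec (EndsWith y P)
  endsWith? y P = map′ suffix⇒++ (λ (R , e) → subst (Suffix _≡_ (y ∷ [])) (sym e) (++⇒suffix R (y ∷ [])))
                       (Suffix.suffix? _≟A_ (y ∷ []) P)

  prefix-or-diverge : ∀ (xs ys : List A) → Prefix _≡_ xs ys ⊎ Prefix _≡_ ys xs ⊎
    (∃ λ K → ∃₂ λ a b → ∃₂ λ R₁ R₂ → a ≢ b × xs ≡ K ++ a ∷ R₁ × ys ≡ K ++ b ∷ R₂)
  prefix-or-diverge []       ys       = inj₁ []
  prefix-or-diverge (x ∷ xs) []       = inj₂ (inj₁ [])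
  prefix-or-diverge (x ∷ xs) (y ∷ ys) with x ≟A y
  ... | no x≢y  = inj₂ (inj₂ ([] , x , y , xs , ys , x≢y , refl , refl))
  ... | yes refl with prefix-or-diverge xs ys
  ...   | inj₁ p                  = inj₁ (refl ∷ p)
  ...   | inj₂ (inj₁ p)           = inj₂ (inj₁ (refl ∷ p))
  ...   | inj₂ (inj₂ (K , a , b , R₁ , R₂ , a≢b , refl , refl)) =
          inj₂ (inj₂ (x ∷ K , a , b , R₁ , R₂ , a≢b , refl , refl))

  suffix-or-diverge : ∀ (xs ys : List A) → Suffix _≡_ xs ys ⊎ Suffix _≡_ ys xs ⊎ Diverge xs ys
  suffix-or-diverge xs ys with prefix-or-diverge (reverse xs) (reverse ys)
  ... | inj₁ p        = inj₁ (Suffix.fromPrefix-rev p)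
  ... | inj₂ (inj₁ p) = inj₂ (inj₁ (Suffix.fromPrefix-rev p))
  ... | inj₂ (inj₂ (K , a , b , R₁ , R₂ , a≢b , e₁ , e₂)) =
        inj₂ (inj₂ (reverse K , a , b , reverse R₁ , reverse R₂ , a≢b , unreverse e₁ , unreverse e₂))
    where
    unreverse : ∀ {X} {c : A} {R} → reverse X ≡ K ++ c ∷ R → X ≡ reverse R ++ c ∷ reverse K
    unreverse {X} {c} {R} e = begin
      X                             ≡⟨ sym (reverse-involutive X) ⟩
      reverse (reverse X)           ≡⟨ cong reverse e ⟩
      reverse (K ++ c ∷ R)          ≡⟨ reverse-++ K (c ∷ R) ⟩
      reverse (c ∷ R) ++ reverse K  ≡⟨ cong (_++ reverse K) (unfold-reverse c R) ⟩
      (reverse R ∷ʳ c) ++ reverse K ≡⟨ ∷ʳ-++ (reverse R) c (reverse K) ⟩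
      reverse R ++ c ∷ reverse K    ∎
      where open ≡-Reasoning

module AcyclicPaths {n : ℕ} (E : Fin n → Fin n → Bool) (acyclic : Graph.Acyclic E) where
  open Graph E

  no-revisit : ∀ X {z} M Y → ¬ Linked Edge (X ++ z ∷ M ++ z ∷ Y)
  no-revisit X {z} M Y l = acyclic z M (s≤s (length≥1 M) , Linked-++⁻ˡ ((z ∷ M) ∷ʳ z) cycle)
    where
    length≥1 : ∀ M → 1 ℕ.≤ length (M ∷ʳ z)
    length≥1 []      = s≤s z≤n
    length≥1 (_ ∷ _) = s≤s z≤n
    cycle : Linked Edge (((z ∷ M) ∷ʳ z) ++ Y)
    cycle = subst (Linked Edge) (sym (∷ʳ-++ (z ∷ M) z Y)) (Linked-++⁻ʳ X l)

  path-parts-disjoint : ∀ X {Y z} → Linked Edge (X ++ Y) → z ∈ X → z ∈ Y → ⊥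
  path-parts-disjoint X {Y} {z} l z∈X z∈Y
    with X₁ , X₂ , refl ← ∈-∃++ z∈X | Y₁ , Y₂ , refl ← ∈-∃++ z∈Y =
    no-revisit X₁ (X₂ ++ Y₁) Y₂ (subst (Linked Edge) reassoc l)
    where
    reassoc : (X₁ ++ z ∷ X₂) ++ Y₁ ++ z ∷ Y₂ ≡ X₁ ++ z ∷ (X₂ ++ Y₁) ++ z ∷ Y₂
    reassoc = trans (++-assoc X₁ (z ∷ X₂) _) (cong (λ T → X₁ ++ z ∷ T) (sym (++-assoc X₂ Y₁ _)))

  ∉-after : ∀ X {y Y} → Linked Edge (X ++ y ∷ Y) → y ∉ Y
  ∉-after X {y} {Y} l = path-parts-disjoint (X ∷ʳ y) (subst (Linked Edge) (sym (∷ʳ-++ X y Y)) l) (∈-++⁺ʳ X (here refl))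

  position-unique : ∀ {xs} X₁ X₂ {y Y₁ Y₂} → Linked Edge xs →
                    xs ≡ X₁ ++ y ∷ Y₁ → xs ≡ X₂ ++ y ∷ Y₂ → X₁ ≡ X₂ × Y₁ ≡ Y₂
  position-unique X₁ X₂ {y} {Y₁} {Y₂} l refl e with ++-overlap X₁ (y ∷ Y₁) X₂ (y ∷ Y₂) e
  ... | inj₁ ([] , p , q)    = sym (trans p (++-identityʳ X₁)) , proj₂ (∷-injective q)
  ... | inj₂ ([] , p , q)    = trans p (++-identityʳ X₂) , proj₂ (∷-injective (sym q))
  ... | inj₁ (m ∷ M , _ , q) with refl , refl ← ∷-injective q =
        ⊥-elim (∉-after X₁ l (∈-++⁺ʳ M (here refl)))
  ... | inj₂ (m ∷ M , _ , q) with refl , refl ← ∷-injective q =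
        ⊥-elim (∉-after X₂ (subst (Linked Edge) e l) (∈-++⁺ʳ M (here refl)))

  splice-pair-unique : ∀ p′ y s′ {c d} → Linked Edge (p′ ++ y ∷ s′) →
                       Infix _≡_ (c ∷ d ∷ []) (p′ ∷ʳ y) → Infix _≡_ (c ∷ d ∷ []) (y ∷ s′) → ⊥
  splice-pair-unique p′ y s′ l i₁ i₂ = path-parts-disjoint p′ l (pair-∷ʳ⇒∈ p′ i₁) (infix⇒∈ i₂)

module Decomposition (F : OrderedField) {n : ℕ} (E : Fin n → Fin n → Bool)
                     (f : Fin n → Fin n → OrderedField.Carrier F) (flowGraph : Flow.IsFlowGraph F E f) where
  open OrderedFieldProperties F
  open Graph E
  open Flow F E f
  open AcyclicPaths E (proj₁ flowGraph)
  open import Data.List.Membership.DecPropositional (_≟_ {n}) using (_∈?_)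

  f-nonneg : ∀ a b → Edge a b → 0# ≤ f a b
  f-nonneg = proj₁ (proj₂ flowGraph)

  WeightedPath : Set
  WeightedPath = List (Fin n) × Carrier

  share : List (Fin n) → WeightedPath → Carrier
  share Q (P , w) = when (subpathOf? Q P) w

  through : List WeightedPath → List (Fin n) → Carrier
  through D Q = ∑ (share Q) D

  total : List WeightedPath → Carrier
  total = ∑ proj₂

  weightThrough≡through : ∀ D Q → weightThrough D Q ≡ through D Q
  weightThrough≡through []            Q = refl
  weightThrough≡through ((P , w) ∷ D) Q with subpathOf? Q P
  ... | yes _ = cong (w +_) (weightThrough≡through D Q)
  ... | no _  = trans (weightThrough≡through D Q) (sym (+-identityˡ _))

  starts? : ∀ (y : Fin n) P → Dec (StartsWith y P)
  starts? = startsWith? _≟_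

  ends? : ∀ (y : Fin n) P → Dec (EndsWith y P)
  ends? = endsWith? _≟_

  -- A stage of the usual construction of a flow decomposition, which splices incoming with outgoing
  -- paths at internal vertices; `resolved` holds the vertices already spliced through.
  record Admissible (resolved : List (Fin n)) (Pw : WeightedPath) : Set where
    constructor mkAdmissible
    field
      isPath   : IsPath (proj₁ Pw)
      positive : 0# < proj₂ Pw
      interior : ∀ z → z ∈ proj₁ Pw → z ∈ resolved ⊎ StartsWith z (proj₁ Pw) ⊎ EndsWith z (proj₁ Pw)
      start∉   : ∀ z → StartsWith z (proj₁ Pw) → z ∉ resolved
      end∉     : ∀ z → EndsWith z (proj₁ Pw) → z ∉ resolved

  record PartialDecomposition (resolved : List (Fin n)) (D : List WeightedPath) : Set where
    constructor mkPartialDecomposition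
    field
      admissible : All (Admissible resolved) D
      exact      : ∀ a b → Edge a b → through D (a ∷ b ∷ []) ≡ f a b

  open Admissible
  open PartialDecomposition

  weights-nonneg : ∀ {resolved D} → All (Admissible resolved) D → All (λ Pw → 0# ≤ proj₂ Pw) D
  weights-nonneg = All.map (inj₁ ∘ positive)

  total-nonneg : ∀ {resolved D} → All (Admissible resolved) D → 0# ≤ total D
  total-nonneg = ∑-nonneg ∘ weights-nonneg

  through-nonneg : ∀ {D} Q → All (λ Pw → 0# ≤ proj₂ Pw) D → 0# ≤ through D Q
  through-nonneg Q = ∑-nonneg ∘ All.map (λ {(P , _)} → when-nonneg (subpathOf? Q P))

  through≤total : ∀ {D} Q → All (λ Pw → 0# ≤ proj₂ Pw) D → through D Q ≤ total D
  through≤total Q = ∑-mono ∘ All.map (λ {(P , _)} → when-≤ (subpathOf? Q P))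

  total≡0⇒through≡0 : ∀ {D} Q → All (λ Pw → 0# ≤ proj₂ Pw) D → total D ≡ 0# → through D Q ≡ 0#
  total≡0⇒through≡0 Q nonneg T≡0 = ≤-antisym (≤-trans (through≤total Q nonneg) (≤-reflexive T≡0)) (through-nonneg Q nonneg)

  through-antitone : ∀ {D Q P} → All (λ Pw → 0# ≤ proj₂ Pw) D → Infix _≡_ Q P → through D P ≤ through D Q
  through-antitone {Q = Q} {P} nonneg Q⊑P = ∑-mono (All.map (λ {(P′ , _)} → pointwise P′) nonneg)
    where
    pointwise : ∀ P′ {w} → 0# ≤ w → when (subpathOf? P P′) w ≤ when (subpathOf? Q P′) w
    pointwise P′ 0≤w with subpathOf? P P′ | subpathOf? Q P′
    ... | yes _    | yes _    = ≤-refl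
    ... | yes P⊑P′ | no Q⋢P′ = ⊥-elim (Q⋢P′ (infix-trans Q⊑P P⊑P′))
    ... | no _     | d        = when-nonneg d 0≤w

  through-absent : ∀ {D Q} → All (λ Pw → ¬ Infix _≡_ Q (proj₁ Pw)) D → through D Q ≡ 0#
  through-absent = ∑-zero ∘ All.map (λ {(P , w)} Q⋢P → when-no (subpathOf? _ P) Q⋢P w)

  positivePart : List WeightedPath → List WeightedPath
  positivePart = filter ((0# <?_) ∘ proj₂)

  through-positivePart : ∀ {D} Q → All (λ Pw → 0# ≤ proj₂ Pw) D → through (positivePart D) Q ≡ through D Q
  through-positivePart {D} Q nonneg = trans (∑-filter ((0# <?_) ∘ proj₂) (share Q) D) (∑-cong (All.map pointwise nonneg))
    where
    pointwise : ∀ {Pw} → 0# ≤ proj₂ Pw → when (0# <? proj₂ Pw) (share Q Pw) ≡ share Q Pw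
    pointwise {P , w} (inj₁ 0<w)  = when-yes (0# <? w) 0<w _
    pointwise {P , w} (inj₂ refl) = trans (when-no (0# <? 0#) <-irrefl _) (sym (when-0 (subpathOf? Q P)))

  starts∧ends⇒⊥ : ∀ {y P} → IsPath P → StartsWith y P → EndsWith y P → ⊥
  starts∧ends⇒⊥ (s≤s () , _) (_ , refl) ([] , refl)
  starts∧ends⇒⊥ (_ , l) (Q , refl) (x ∷ R , e) with refl , refl ← ∷-injective e =
    ∉-after [] l (endsWith⇒∈ (R , refl))

  data Position (y : Fin n) (P : List (Fin n)) : Set where
    avoids : y ∉ P → Position y P
    ends   : EndsWith y P → ¬ StartsWith y P → Position y P
    starts : StartsWith y P → ¬ EndsWith y P → Position y P

  position : ∀ {resolved y Pw} → Admissible resolved Pw → y ∉ resolved → Position y (proj₁ Pw)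
  position {y = y} {P , _} a y∉ with y ∈? P
  ... | no y∉P = avoids y∉P
  ... | yes y∈P with interior a y y∈P
  ...   | inj₁ y∈        = ⊥-elim (y∉ y∈)
  ...   | inj₂ (inj₁ st) = starts st (starts∧ends⇒⊥ (isPath a) st)
  ...   | inj₂ (inj₂ en) = ends en (λ st → starts∧ends⇒⊥ (isPath a) st en)

  Avoids EndsAt StartsAt : Fin n → WeightedPath → Set
  Avoids   y (P , _) = y ∉ P
  EndsAt   y (P , _) = EndsWith y P
  StartsAt y (P , _) = StartsWith y P

  avoids? : ∀ y → Decidable (Avoids y)
  avoids? y (P , _) = ¬? (y ∈? P)

  endsAt? : ∀ y → Decidable (EndsAt y)
  endsAt? y (P , _) = ends? y P

  startsAt? : ∀ y → Decidable (StartsAt y)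
  startsAt? y (P , _) = starts? y P

  avoiding endingAt startingAt : Fin n → List WeightedPath → List WeightedPath
  avoiding   y = filter (avoids? y)
  endingAt   y = filter (endsAt? y)
  startingAt y = filter (startsAt? y)

  ∑-split-at : ∀ {resolved y} (h : WeightedPath → Carrier) D → All (Admissible resolved) D → y ∉ resolved →
               ∑ h D ≡ ∑ h (avoiding y D) + ∑ h (endingAt y D) + ∑ h (startingAt y D)
  ∑-split-at {y = y} h D as y∉ =
    trans (∑-cong (All.map (λ a → pointwise (position a y∉)) as))
   (trans (∑-+ _ _ D)
          (cong₂ _+_ (trans (∑-+ _ _ D) (cong₂ _+_ (sym (∑-filter (avoids? y) h D))
                                                 (sym (∑-filter (endsAt? y) h D))))
                     (sym (∑-filter (startsAt? y) h D))))
    where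
    pointwise : ∀ {Pw} → Position y (proj₁ Pw) →
                h Pw ≡ when (avoids? y Pw) (h Pw) + when (endsAt? y Pw) (h Pw) + when (startsAt? y Pw) (h Pw)
    pointwise {P , w} (avoids y∉P) = sym (trans
      (cong₂ _+_ (cong₂ _+_ (when-yes (¬? (y ∈? P)) y∉P _) (when-no (ends? y P) (y∉P ∘ endsWith⇒∈) _))
                 (when-no (starts? y P) (y∉P ∘ startsWith⇒∈) _))
      (trans (+-identityʳ _) (+-identityʳ _)))
    pointwise {P , w} (ends en ¬st) = sym (trans
      (cong₂ _+_ (cong₂ _+_ (when-no (¬? (y ∈? P)) (λ y∉P → y∉P (endsWith⇒∈ en)) _) (when-yes (ends? y P) en _))
                 (when-no (starts? y P) ¬st _))
      (trans (+-identityʳ _) (+-identityˡ _)))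
    pointwise {P , w} (starts st ¬en) = sym (trans
      (cong₂ _+_ (cong₂ _+_ (when-no (¬? (y ∈? P)) (λ y∉P → y∉P (startsWith⇒∈ st)) _) (when-no (ends? y P) ¬en _))
                 (when-yes (starts? y P) st _))
      (trans (cong (_+ h (P , w)) (+-identityʳ 0#)) (+-identityˡ _)))

  single-not-path : ∀ {y} → ¬ IsPath (y ∷ [])
  single-not-path (s≤s () , _)

  inflow-share : ∀ {resolved y} Pw → Admissible resolved Pw → y ∉ resolved →
                 ∑ (λ z → share (z ∷ y ∷ []) Pw) (allFin n) ≡ when (endsAt? y Pw) (proj₂ Pw)
  inflow-share {y = y} (P , w) a y∉ with endsAt? y (P , w)
  ... | yes (R , refl) with initLast R
  ...   | []        = ⊥-elim (single-not-path (isPath a))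
  ...   | R′ ∷ʳ′ z₀ = trans (∑-allFin-single n _ z₀ others) (when-yes (subpathOf? _ P) last-pair w)
    where
    P≡ : P ≡ R′ ++ z₀ ∷ y ∷ []
    P≡ = ++-assoc R′ (z₀ ∷ []) (y ∷ [])
    last-pair : Infix _≡_ (z₀ ∷ y ∷ []) P
    last-pair = ++⇒infix R′ _ [] P≡
    predecessor : ∀ {z} → Infix _≡_ (z ∷ y ∷ []) P → z ≡ z₀
    predecessor {z} i with X , Y , e ← infix⇒++ i =
      proj₂ (∷ʳ-injective X R′ (proj₁ (position-unique (X ∷ʳ z) (R′ ∷ʳ z₀) (proj₂ (isPath a))
        (trans e (sym (∷ʳ-++ X z (y ∷ Y)))) (trans P≡ (sym (∷ʳ-++ R′ z₀ (y ∷ [])))))))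
    others : ∀ z → z ≢ z₀ → share (z ∷ y ∷ []) (P , w) ≡ 0#
    others z z≢z₀ = when-no (subpathOf? _ P) (z≢z₀ ∘ predecessor) w
  inflow-share {y = y} (P , w) a y∉ | no ¬en =
    ∑-zero {xs = allFin n} (All.tabulate (λ {z} _ → when-no (subpathOf? _ P) (no-pair z) w))
    where
    no-pair : ∀ z → ¬ Infix _≡_ (z ∷ y ∷ []) P
    no-pair z i with X , Y , e ← infix⇒++ i
                 with interior a y (subst (y ∈_) (sym e) (∈-++⁺ʳ X (there (here refl))))
    ... | inj₁ y∈             = y∉ y∈
    ... | inj₂ (inj₂ en)      = ¬en en
    ... | inj₂ (inj₁ (Q , P≡)) with () ← ++-conicalʳ X (z ∷ []) (sym (proj₁ (position-unique [] (X ∷ʳ z)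
                                        (proj₂ (isPath a)) P≡ (trans e (sym (∷ʳ-++ X z (y ∷ Y)))))))

  outflow-share : ∀ {resolved y} Pw → Admissible resolved Pw → y ∉ resolved →
                  ∑ (λ t → share (y ∷ t ∷ []) Pw) (allFin n) ≡ when (startsAt? y Pw) (proj₂ Pw)
  outflow-share {y = y} (P , w) a y∉ with startsAt? y (P , w)
  ... | yes ([] , refl)      = ⊥-elim (single-not-path (isPath a))
  ... | yes (t₀ ∷ Q′ , refl) = trans (∑-allFin-single n _ t₀ others) (when-yes (subpathOf? _ P) (++⇒infix [] _ Q′ refl) w)
    where
    successor : ∀ {t} → Infix _≡_ (y ∷ t ∷ []) P → t ≡ t₀
    successor i with X , Y , e ← infix⇒++ i =
      sym (proj₁ (∷-injective (proj₂ (position-unique [] X (proj₂ (isPath a)) refl e))))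
    others : ∀ t → t ≢ t₀ → share (y ∷ t ∷ []) (P , w) ≡ 0#
    others t t≢t₀ = when-no (subpathOf? _ P) (t≢t₀ ∘ successor) w
  outflow-share {y = y} (P , w) a y∉ | no ¬st =
    ∑-zero {xs = allFin n} (All.tabulate (λ {t} _ → when-no (subpathOf? _ P) (no-pair t) w))
    where
    no-pair : ∀ t → ¬ Infix _≡_ (y ∷ t ∷ []) P
    no-pair t i with X , Y , e ← infix⇒++ i with interior a y (subst (y ∈_) (sym e) (∈-++⁺ʳ X (here refl)))
    ... | inj₁ y∈          = y∉ y∈
    ... | inj₂ (inj₁ st)   = ¬st st
    ... | inj₂ (inj₂ (R , P≡)) with () ← proj₂ (position-unique X R (proj₂ (isPath a)) e P≡)

  fE-nonneg : ∀ a b → 0# ≤ fE a b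
  fE-nonneg a b with E a b in e
  ... | true  = f-nonneg a b e
  ... | false = ≤-refl

  fE-edge : ∀ {a b} → Edge a b → fE a b ≡ f a b
  fE-edge {a} {b} e rewrite e = refl

  fE≡through : ∀ {resolved D} → PartialDecomposition resolved D → ∀ a b → fE a b ≡ through D (a ∷ b ∷ [])
  fE≡through pd a b with E a b in e
  ... | true  = sym (exact pd a b e)
  ... | false = sym (through-absent (All.map (λ a′ i → non-edge (Linked-infix (proj₂ (isPath a′)) i)) (admissible pd)))
    where
    non-edge : ¬ Edge a b
    non-edge e′ with () ← trans (sym e) e′

  f-in≡total : ∀ {resolved D y} → PartialDecomposition resolved D → y ∉ resolved → f-in y ≡ total (endingAt y D)
  f-in≡total {D = D} {y} pd y∉ = begin
    f-in y
      ≡⟨ sum-map (λ z → fE z y) (allFin n) ⟩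
    ∑ (λ z → fE z y) (allFin n)
      ≡⟨ ∑-≗ (λ z → fE≡through pd z y) (allFin n) ⟩
    ∑ (λ z → through D (z ∷ y ∷ [])) (allFin n)
      ≡⟨ sym (∑-comm (λ Pw z → share (z ∷ y ∷ []) Pw) D (allFin n)) ⟩
    ∑ (λ Pw → ∑ (λ z → share (z ∷ y ∷ []) Pw) (allFin n)) D
      ≡⟨ ∑-cong (All.map (λ a → inflow-share _ a y∉) (admissible pd)) ⟩
    ∑ (λ Pw → when (endsAt? y Pw) (proj₂ Pw)) D
      ≡⟨ sym (∑-filter (endsAt? y) proj₂ D) ⟩
    total (endingAt y D) ∎
    where open ≡-Reasoning

  f-out≡total : ∀ {resolved D y} → PartialDecomposition resolved D → y ∉ resolved → f-out y ≡ total (startingAt y D)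
  f-out≡total {D = D} {y} pd y∉ = begin
    f-out y
      ≡⟨ sum-map (fE y) (allFin n) ⟩
    ∑ (fE y) (allFin n)
      ≡⟨ ∑-≗ (fE≡through pd y) (allFin n) ⟩
    ∑ (λ t → through D (y ∷ t ∷ [])) (allFin n)
      ≡⟨ sym (∑-comm (λ Pw t → share (y ∷ t ∷ []) Pw) D (allFin n)) ⟩
    ∑ (λ Pw → ∑ (λ t → share (y ∷ t ∷ []) Pw) (allFin n)) D
      ≡⟨ ∑-cong (All.map (λ a → outflow-share _ a y∉) (admissible pd)) ⟩
    ∑ (λ Pw → when (startsAt? y Pw) (proj₂ Pw)) D
      ≡⟨ sym (∑-filter (startsAt? y) proj₂ D) ⟩
    total (startingAt y D) ∎
    where open ≡-Reasoning

  -- Splicing at a vertex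

  splice : List (Fin n) → List (Fin n) → List (Fin n)
  splice p s = p ++ drop 1 s

  splices : List WeightedPath → List WeightedPath → Carrier → List WeightedPath
  splices L R c = concatMap (λ pw → map (λ sw → splice (proj₁ pw) (proj₁ sw) , proj₂ pw * proj₂ sw * c) R) L

  occurs : List (Fin n) → List (Fin n) → Carrier
  occurs Q P = when (subpathOf? Q P) 1#

  through≡∑occurs : ∀ D Q → through D Q ≡ ∑ (λ Pw → occurs Q (proj₁ Pw) * proj₂ Pw) D
  through≡∑occurs D Q = ∑-≗ (λ (P , w) → when-≡-* (subpathOf? Q P) w) D

  splice-linked : ∀ {y p s} → EndsWith y p → Linked Edge p → StartsWith y s → Linked Edge s →
                  Linked Edge (splice p s)
  splice-linked {y} (R , refl) lp (Q , refl) ls = subst (Linked Edge) (sym (∷ʳ-++ R y Q)) (Linked-splice R lp ls)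

  -- By acyclicity, an edge of a spliced path lies on exactly one of the two halves.
  occurs-split : ∀ R y Q {c d} → Linked Edge (R ++ y ∷ Q) →
                  occurs (c ∷ d ∷ []) (R ++ y ∷ Q) ≡ occurs (c ∷ d ∷ []) (R ∷ʳ y) + occurs (c ∷ d ∷ []) (y ∷ Q)
  occurs-split R y Q {c} {d} l with subpathOf? (c ∷ d ∷ []) (R ++ y ∷ Q) | subpathOf? (c ∷ d ∷ []) (R ∷ʳ y)
                                 | subpathOf? (c ∷ d ∷ []) (y ∷ Q)
  ... | _     | yes i₁ | yes i₂ = ⊥-elim (splice-pair-unique R y Q l i₁ i₂)
  ... | yes _ | yes _  | no _   = sym (+-identityʳ 1#)
  ... | yes _ | no _   | yes _  = sym (+-identityˡ 1#)
  ... | yes i | no ¬i₁ | no ¬i₂ = ⊥-elim ([ ¬i₁ , ¬i₂ ]′ (splice-pair⁻ R y Q i))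
  ... | no ¬i | yes i₁ | no _   = ⊥-elim (¬i (splice-infixˡ R y Q i₁))
  ... | no ¬i | no _   | yes i₂ = ⊥-elim (¬i (splice-infixʳ R y Q i₂))
  ... | no _  | no _   | no _   = sym (+-identityʳ 0#)

  occurs-splice : ∀ {y p s} → EndsWith y p → Linked Edge p → StartsWith y s → Linked Edge s → ∀ c d →
                   occurs (c ∷ d ∷ []) (splice p s) ≡ occurs (c ∷ d ∷ []) p + occurs (c ∷ d ∷ []) s
  occurs-splice {y} (R , refl) lp (Q , refl) ls c d =
    trans (cong (occurs (c ∷ d ∷ [])) (∷ʳ-++ R y Q)) (occurs-split R y Q (Linked-splice R lp ls))

  splice-chain : ∀ C {y z p s} → EndsWith y p → Linked Edge p → StartsWith y s → Linked Edge s →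
                 Infix _≡_ (C ++ y ∷ z ∷ []) (splice p s) → Suffix _≡_ (C ∷ʳ y) p × Infix _≡_ (y ∷ z ∷ []) s
  splice-chain C {y} {z} (R , refl) lp (Q , refl) ls C⊑ = conclude (infix⇒++ C⊑)
    where
    R++Q : (R ∷ʳ y) ++ Q ≡ R ++ y ∷ Q
    R++Q = ∷ʳ-++ R y Q
    reassoc : ∀ X Y → X ++ (C ++ y ∷ z ∷ []) ++ Y ≡ (X ++ C) ++ y ∷ z ∷ Y
    reassoc X Y = trans (cong (X ++_) (++-assoc C (y ∷ z ∷ []) Y)) (sym (++-assoc X C (y ∷ z ∷ Y)))
    conclude : (∃₂ λ X Y → (R ∷ʳ y) ++ Q ≡ X ++ (C ++ y ∷ z ∷ []) ++ Y) →
               Suffix _≡_ (C ∷ʳ y) (R ∷ʳ y) × Infix _≡_ (y ∷ z ∷ []) (y ∷ Q)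
    conclude (X , Y , e)
      with refl , refl ← position-unique R (X ++ C) (Linked-splice R lp ls) refl (trans (sym R++Q) (trans e (reassoc X Y))) =
      subst (Suffix _≡_ (C ∷ʳ y)) (sym (++-assoc X C (y ∷ []))) (++⇒suffix X (C ∷ʳ y)) , ++⇒infix [] _ Y refl

  share-splice : ∀ {y p s} → EndsWith y p → Linked Edge p → StartsWith y s → Linked Edge s → ∀ a b wp ws c →
                 share (a ∷ b ∷ []) (splice p s , wp * ws * c)
                 ≡ (occurs (a ∷ b ∷ []) p * wp * c) * ws + (wp * c) * (occurs (a ∷ b ∷ []) s * ws)
  share-splice {p = p} {s} en lp st ls a b wp ws c =
    trans (when-≡-* (subpathOf? (a ∷ b ∷ []) (splice p s)) _)
          (trans (cong (_* (wp * ws * c)) (occurs-splice en lp st ls a b)) (distribute _ _ wp ws c))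
    where
    distribute : ∀ o o′ w w′ c → (o + o′) * (w * w′ * c) ≡ (o * w * c) * w′ + (w * c) * (o′ * w′)
    distribute = solve 5 (λ o o′ w w′ c → (o :+ o′) :* (w :* w′ :* c) := (o :* w :* c) :* w′ :+ (w :* c) :* (o′ :* w′)) refl

  through-spliced-with : ∀ {y p} R c → EndsWith y p → Linked Edge p →
                         All (λ sw → StartsWith y (proj₁ sw) × Linked Edge (proj₁ sw)) R → ∀ a b wp →
                         through (map (λ sw → splice p (proj₁ sw) , wp * proj₂ sw * c) R) (a ∷ b ∷ [])
                         ≡ (c * total R) * (occurs (a ∷ b ∷ []) p * wp) + (c * through R (a ∷ b ∷ [])) * wp
  through-spliced-with {p = p} R c en lp Rs a b wp = begin
    through (map (λ sw → splice p (proj₁ sw) , wp * proj₂ sw * c) R) e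
      ≡⟨ ∑-map (share e) _ R ⟩
    ∑ (λ sw → share e (splice p (proj₁ sw) , wp * proj₂ sw * c)) R
      ≡⟨ ∑-cong (All.map (λ {(s , ws)} (st , ls) → share-splice en lp st ls a b wp ws c) Rs) ⟩
    ∑ (λ sw → (occurs e p * wp * c) * proj₂ sw + (wp * c) * (occurs e (proj₁ sw) * proj₂ sw)) R
      ≡⟨ ∑-+ _ _ R ⟩
    ∑ (λ sw → (occurs e p * wp * c) * proj₂ sw) R + ∑ (λ sw → (wp * c) * (occurs e (proj₁ sw) * proj₂ sw)) R
      ≡⟨ cong₂ _+_ (∑-*ˡ _ proj₂ R) (trans (∑-*ˡ (wp * c) _ R) (cong (wp * c *_) (sym (through≡∑occurs R e)))) ⟩
    (occurs e p * wp * c) * total R + (wp * c) * through R e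
      ≡⟨ regroup (occurs e p) wp c (total R) (through R e) ⟩
    (c * total R) * (occurs e p * wp) + (c * through R e) * wp ∎
    where
    open ≡-Reasoning
    e = a ∷ b ∷ []
    regroup : ∀ o w c TR WR → (o * w * c) * TR + (w * c) * WR ≡ (c * TR) * (o * w) + (c * WR) * w
    regroup = solve 5 (λ o w c TR WR → (o :* w :* c) :* TR :+ (w :* c) :* WR := (c :* TR) :* (o :* w) :+ (c :* WR) :* w) refl

  through-splices : ∀ {y} L R c → All (λ pw → EndsWith y (proj₁ pw) × Linked Edge (proj₁ pw)) L →
                    All (λ sw → StartsWith y (proj₁ sw) × Linked Edge (proj₁ sw)) R → ∀ a b →
                    through (splices L R c) (a ∷ b ∷ [])
                    ≡ c * (total R * through L (a ∷ b ∷ []) + total L * through R (a ∷ b ∷ []))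
  through-splices L R c Ls Rs a b = begin
    through (splices L R c) e
      ≡⟨ ∑-concatMap (share e) _ L ⟩
    ∑ (λ pw → through (map (λ sw → splice (proj₁ pw) (proj₁ sw) , proj₂ pw * proj₂ sw * c) R) e) L
      ≡⟨ ∑-cong (All.map (λ {(p , wp)} (en , lp) → through-spliced-with R c en lp Rs a b wp) Ls) ⟩
    ∑ (λ pw → (c * total R) * (occurs e (proj₁ pw) * proj₂ pw) + (c * through R e) * proj₂ pw) L
      ≡⟨ ∑-+ _ _ L ⟩
    ∑ (λ pw → (c * total R) * (occurs e (proj₁ pw) * proj₂ pw)) L + ∑ (λ pw → (c * through R e) * proj₂ pw) L
      ≡⟨ cong₂ _+_ (trans (∑-*ˡ (c * total R) _ L) (cong (c * total R *_) (sym (through≡∑occurs L e))))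
                   (∑-*ˡ (c * through R e) proj₂ L) ⟩
    (c * total R) * through L e + (c * through R e) * total L
      ≡⟨ factor c (total R) (through L e) (through R e) (total L) ⟩
    c * (total R * through L e + total L * through R e) ∎
    where
    open ≡-Reasoning
    e = a ∷ b ∷ []
    factor : ∀ c TR WL WR TL → (c * TR) * WL + (c * WR) * TL ≡ c * (TR * WL + TL * WR)
    factor = solve 5 (λ c TR WL WR TL → (c :* TR) :* WL :+ (c :* WR) :* TL := c :* (TR :* WL :+ TL :* WR)) refl

  All-splices : ∀ {A B Q : WeightedPath → Set} {L R c} →
                (∀ {p wp s ws} → A (p , wp) → B (s , ws) → Q (splice p s , wp * ws * c)) →
                All A L → All B R → All Q (splices L R c)
  All-splices h AL BR = All-concatMap _ (All.map (λ a → All.map⁺ (All.map (h a) BR)) AL)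

  avoiding-admissible : ∀ {resolved y Pw} → Admissible resolved Pw → Avoids y Pw → Admissible (y ∷ resolved) Pw
  avoiding-admissible {resolved} {y} {P , w} a y∉P = mkAdmissible (isPath a) (positive a) interior′ start∉′ end∉′
    where
    interior′ : ∀ z → z ∈ P → z ∈ y ∷ resolved ⊎ StartsWith z P ⊎ EndsWith z P
    interior′ z z∈P with interior a z z∈P
    ... | inj₁ z∈ = inj₁ (there z∈)
    ... | inj₂ r  = inj₂ r
    start∉′ : ∀ z → StartsWith z P → z ∉ y ∷ resolved
    start∉′ z st (here refl) = y∉P (startsWith⇒∈ st)
    start∉′ z st (there z∈) = start∉ a z st z∈
    end∉′ : ∀ z → EndsWith z P → z ∉ y ∷ resolved
    end∉′ z en (here refl) = y∉P (endsWith⇒∈ en)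
    end∉′ z en (there z∈) = end∉ a z en z∈

  splice-admissible : ∀ {resolved y p wp s ws} → y ∉ resolved →
                      Admissible resolved (p , wp) × EndsWith y p → Admissible resolved (s , ws) × StartsWith y s →
                      ∀ {w} → 0# < w → Admissible (y ∷ resolved) (splice p s , w)
  splice-admissible {resolved} {y} {p} y∉ (ap , en) (as , (Q , refl)) 0<w =
    mkAdmissible (length≥2 , splice-linked en (proj₂ (isPath ap)) (Q , refl) (proj₂ (isPath as)))
                 0<w interior′ start∉′ end∉′
    where
    Q≢[] : Q ≢ []
    Q≢[] refl = single-not-path (isPath as)
    p≢[] : p ≢ []
    p≢[] refl with () ← proj₁ (isPath ap)
    length≥2 : 2 ℕ.≤ length (p ++ Q)
    length≥2 = subst (2 ℕ.≤_) (sym (length-++ p)) (ℕₚ.≤-trans (proj₁ (isPath ap)) (ℕₚ.m≤m+n _ _))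
    interior′ : ∀ z → z ∈ p ++ Q → z ∈ y ∷ resolved ⊎ StartsWith z (p ++ Q) ⊎ EndsWith z (p ++ Q)
    interior′ z z∈ with ∈-++⁻ p z∈
    ... | inj₁ z∈p with interior ap z z∈p
    ...   | inj₁ z∈r        = inj₁ (there z∈r)
    ...   | inj₂ (inj₁ st)  = inj₂ (inj₁ (startsWith-++⁺ Q st))
    ...   | inj₂ (inj₂ en′) = inj₁ (here (endsWith-unique en′ en))
    interior′ z z∈ | inj₂ z∈Q with interior as z (there z∈Q)
    ...   | inj₁ z∈r        = inj₁ (there z∈r)
    ...   | inj₂ (inj₁ st)  = inj₁ (here (startsWith-unique st (Q , refl)))
    ...   | inj₂ (inj₂ en′) = inj₂ (inj₂ (endsWith-++⁺ p (endsWith-++⁻ (y ∷ []) Q≢[] en′)))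
    start∉′ : ∀ z → StartsWith z (p ++ Q) → z ∉ y ∷ resolved
    start∉′ z st (here refl) = starts∧ends⇒⊥ (isPath ap) (startsWith-++⁻ p p≢[] st) en
    start∉′ z st (there z∈) = start∉ ap z (startsWith-++⁻ p p≢[] st) z∈
    end∉′ : ∀ z → EndsWith z (p ++ Q) → z ∉ y ∷ resolved
    end∉′ z en′ (here refl) = starts∧ends⇒⊥ (isPath as) (Q , refl) (endsWith-++⁺ (y ∷ []) (endsWith-++⁻ p Q≢[] en′))
    end∉′ z en′ (there z∈) = end∉ as z (endsWith-++⁺ (y ∷ []) (endsWith-++⁻ p Q≢[] en′)) z∈

  linked-ends : ∀ {resolved y L} → All (λ Pw → Admissible resolved Pw × EndsAt y Pw) L →
                All (λ pw → EndsWith y (proj₁ pw) × Linked Edge (proj₁ pw)) L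
  linked-ends = All.map (λ (a , en) → en , proj₂ (isPath a))

  linked-starts : ∀ {resolved y R} → All (λ Pw → Admissible resolved Pw × StartsAt y Pw) R →
                  All (λ sw → StartsWith y (proj₁ sw) × Linked Edge (proj₁ sw)) R
  linked-starts = All.map (λ (a , st) → st , proj₂ (isPath a))

  module _ {resolved D} (pd : PartialDecomposition resolved D) (y : Fin n) where

    endingAt-admissible : All (λ Pw → Admissible resolved Pw × EndsAt y Pw) (endingAt y D)
    endingAt-admissible = All.zip (All.filter⁺ (endsAt? y) (admissible pd) , All.all-filter (endsAt? y) D)

    startingAt-admissible : All (λ Pw → Admissible resolved Pw × StartsAt y Pw) (startingAt y D)
    startingAt-admissible = All.zip (All.filter⁺ (startsAt? y) (admissible pd) , All.all-filter (startsAt? y) D)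

    avoidingAt-admissible : All (Admissible (y ∷ resolved)) (avoiding y D)
    avoidingAt-admissible = All.map (λ (a , y∉) → avoiding-admissible a y∉)
                                   (All.zip (All.filter⁺ (avoids? y) (admissible pd) , All.all-filter (avoids? y) D))

    through-split-at : y ∉ resolved → ∀ Q →
      through D Q ≡ through (avoiding y D) Q + through (endingAt y D) Q + through (startingAt y D) Q
    through-split-at y∉ Q = ∑-split-at (share Q) D (admissible pd) y∉

  -- Resolving internal vertices

  Internal : Fin n → Set
  Internal y = ¬ IsSource y × ¬ IsSink y

  internal? : ∀ y → Dec (Internal y)
  internal? y = ¬? (f-in y ≈? 0#) ×-dec ¬? (f-out y ≈? 0#)

  total-in≡total-out : ∀ {resolved D y} → PartialDecomposition resolved D → y ∉ resolved → Internal y →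
                       total (endingAt y D) ≡ total (startingAt y D)
  total-in≡total-out pd y∉ (¬source , ¬sink) =
    trans (sym (f-in≡total pd y∉)) (trans (proj₂ (proj₂ flowGraph) _ ¬source ¬sink) (f-out≡total pd y∉))

  0<total-in : ∀ {resolved D y} → PartialDecomposition resolved D → y ∉ resolved → Internal y → 0# < total (endingAt y D)
  0<total-in pd y∉ (¬source , _) =
    0≤∧≢0⇒0< (total-nonneg (All.map proj₁ (endingAt-admissible pd _))) (¬source ∘ trans (f-in≡total pd y∉))

  resolve : ∀ {resolved D y} → PartialDecomposition resolved D → y ∉ resolved → Internal y →
            Σ (List WeightedPath) (PartialDecomposition (y ∷ resolved))
  resolve {resolved} {D} {y} pd y∉ internal =
    avoiding y D ++ splices L R c , mkPartialDecomposition admissible′ exact′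
    where
    L = endingAt y D
    R = startingAt y D
    c = total L ⁻¹
    0<TL : 0# < total L
    0<TL = 0<total-in pd y∉ internal
    admissible′ : All (Admissible (y ∷ resolved)) (avoiding y D ++ splices L R c)
    admissible′ = All.++⁺ (avoidingAt-admissible pd y)
      (All-splices (λ pa@(a , _) sa@(a′ , _) → splice-admissible y∉ pa sa (*-pos (*-pos (positive a) (positive a′)) (⁻¹-pos 0<TL)))
                   (endingAt-admissible pd y) (startingAt-admissible pd y))
    cancel : ∀ x y → c * (total L * x + total L * y) ≡ x + y
    cancel x y = trans (solve 4 (λ c T x y → c :* (T :* x :+ T :* y) := (T :* c) :* (x :+ y)) refl c (total L) x y)
                       (trans (cong (_* (x + y)) (*-inverseʳ (<⇒≢ 0<TL ∘ sym))) (*-identityˡ (x + y)))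
    exact′ : ∀ a b → Edge a b → through (avoiding y D ++ splices L R c) (a ∷ b ∷ []) ≡ f a b
    exact′ a b ab = begin
      through (avoiding y D ++ splices L R c) e
        ≡⟨ ∑-++ (share e) (avoiding y D) _ ⟩
      through (avoiding y D) e + through (splices L R c) e
        ≡⟨ cong (through (avoiding y D) e +_)
                (through-splices L R c (linked-ends (endingAt-admissible pd y)) (linked-starts (startingAt-admissible pd y)) a b) ⟩
      through (avoiding y D) e + c * (total R * through L e + total L * through R e)
        ≡⟨ cong (λ T → through (avoiding y D) e + c * (T * through L e + total L * through R e))
                (sym (total-in≡total-out pd y∉ internal)) ⟩
      through (avoiding y D) e + c * (total L * through L e + total L * through R e)
        ≡⟨ cong (through (avoiding y D) e +_) (cancel (through L e) (through R e)) ⟩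
      through (avoiding y D) e + (through L e + through R e) ≡⟨ sym (+-assoc _ _ _) ⟩
      through (avoiding y D) e + through L e + through R e   ≡⟨ sym (through-split-at pd y y∉ e) ⟩
      through D e                                            ≡⟨ exact pd a b ab ⟩
      f a b                                                  ∎
      where
      open ≡-Reasoning
      e = a ∷ b ∷ []

  edge? : ∀ a b → Dec (Edge a b)
  edge? a b = E a b Bool.≟ true

  edgePath : Fin n → Fin n → List WeightedPath
  edgePath a b with edge? a b | 0# <? f a b
  ... | yes _ | yes _ = (a ∷ b ∷ [] , f a b) ∷ []
  ... | _     | _     = []

  edgePath-admissible : ∀ a b → All (Admissible []) (edgePath a b)
  edgePath-admissible a b with edge? a b | 0# <? f a b
  ... | yes ab | yes 0<f = mkAdmissible (s≤s (s≤s z≤n) , ab ∷ [-]) 0<f endpoint (λ _ _ ()) (λ _ _ ()) ∷ []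
    where
    endpoint : ∀ z → z ∈ a ∷ b ∷ [] → z ∈ [] ⊎ StartsWith z (a ∷ b ∷ []) ⊎ EndsWith z (a ∷ b ∷ [])
    endpoint z (here refl)         = inj₂ (inj₁ (_ , refl))
    endpoint z (there (here refl)) = inj₂ (inj₂ (a ∷ [] , refl))
  ... | yes _ | no _  = []
  ... | no _  | _     = []

  pair⊑pair : ∀ {a b c d : Fin n} → Infix _≡_ (c ∷ d ∷ []) (a ∷ b ∷ []) → c ≡ a × d ≡ b
  pair⊑pair (here (refl ∷ refl ∷ [])) = refl , refl
  pair⊑pair (there (here (_ ∷ ())))
  pair⊑pair (there (there (here ())))

  through-edgePath-other : ∀ {c d} a b → ¬ (c ≡ a × d ≡ b) → through (edgePath a b) (c ∷ d ∷ []) ≡ 0#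
  through-edgePath-other {c} {d} a b ≢ab with edge? a b | 0# <? f a b
  ... | yes _ | yes _ = trans (+-identityʳ _) (when-no (subpathOf? (c ∷ d ∷ []) (a ∷ b ∷ [])) (≢ab ∘ pair⊑pair) _)
  ... | yes _ | no _  = refl
  ... | no _  | _     = refl

  through-edgePath-self : ∀ {a b} → Edge a b → through (edgePath a b) (a ∷ b ∷ []) ≡ f a b
  through-edgePath-self {a} {b} ab with edge? a b | 0# <? f a b
  ... | yes _  | yes _  = trans (+-identityʳ _) (when-yes (subpathOf? (a ∷ b ∷ []) (a ∷ b ∷ [])) (here (refl ∷ refl ∷ [])) _)
  ... | yes _  | no f≯0 = ≤-antisym (f-nonneg a b ab) (≮⇒≥ f≯0)
  ... | no ¬ab | _      = ⊥-elim (¬ab ab)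

  edgeDecomposition : List WeightedPath
  edgeDecomposition = concatMap (λ a → concatMap (edgePath a) (allFin n)) (allFin n)

  edgeDecomposition-partial : PartialDecomposition [] edgeDecomposition
  edgeDecomposition-partial = mkPartialDecomposition
    (All-concatMap (λ a → concatMap (edgePath a) (allFin n)) {allFin n}
       (All.tabulate λ {a} _ → All-concatMap (edgePath a) {allFin n} (All.tabulate λ {b} _ → edgePath-admissible a b)))
    exact′
    where
    exact′ : ∀ c d → Edge c d → through edgeDecomposition (c ∷ d ∷ []) ≡ f c d
    exact′ c d cd = begin
      through edgeDecomposition e
        ≡⟨ ∑-concatMap (share e) _ (allFin n) ⟩
      ∑ (λ a → through (concatMap (edgePath a) (allFin n)) e) (allFin n)
        ≡⟨ ∑-≗ (λ a → ∑-concatMap (share e) (edgePath a) (allFin n)) (allFin n) ⟩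
      ∑ (λ a → ∑ (λ b → through (edgePath a b) e) (allFin n)) (allFin n)
        ≡⟨ ∑-allFin-single n _ c (λ a a≢c → ∑-zero {xs = allFin n}
             (All.tabulate λ {b} _ → through-edgePath-other a b (a≢c ∘ sym ∘ proj₁))) ⟩
      ∑ (λ b → through (edgePath c b) e) (allFin n)
        ≡⟨ ∑-allFin-single n _ d (λ b b≢d → through-edgePath-other c b (b≢d ∘ sym ∘ proj₂)) ⟩
      through (edgePath c d) e
        ≡⟨ through-edgePath-self cd ⟩
      f c d ∎
      where
      open ≡-Reasoning
      e = c ∷ d ∷ []

  decompose : ∀ vs → All Internal vs → Unique vs → Σ (List WeightedPath) (PartialDecomposition vs)
  decompose []       _          _          = edgeDecomposition , edgeDecomposition-partial
  decompose (y ∷ vs) (iy ∷ ivs) (y∉ ∷ uvs) =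
    resolve (proj₂ (decompose vs ivs uvs)) (λ y∈vs → All.lookup y∉ y∈vs refl) iy

  internalsOutside : List (Fin n) → List (Fin n)
  internalsOutside X = filter (λ y → internal? y ×-dec ¬? (y ∈? X)) (allFin n)

  internal⇒∈internalsOutside : ∀ {X y} → Internal y → y ∉ X → y ∈ internalsOutside X
  internal⇒∈internalsOutside {X} {y} iy y∉X = ∈-filter⁺ (λ y → internal? y ×-dec ¬? (y ∈? X)) (∈-allFin y) (iy , y∉X)

  ∈internalsOutside⇒∉ : ∀ {X y} → y ∈ internalsOutside X → y ∉ X
  ∈internalsOutside⇒∉ {X} y∈ = proj₂ (proj₂ (∈-filter⁻ (λ y → internal? y ×-dec ¬? (y ∈? X)) {xs = allFin n} y∈))

  decomposeOutside : ∀ X → Σ (List WeightedPath) (PartialDecomposition (internalsOutside X))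
  decomposeOutside X = decompose (internalsOutside X) (All.map proj₁ (All.all-filter _ (allFin n)))
                                 (Unique.filter⁺ _ (Unique.allFin⁺ n))

  f≤f-out : ∀ {a b} → Edge a b → f a b ≤ f-out a
  f≤f-out {a} {b} ab = subst₂ _≤_ (fE-edge ab) (sym (sum-map (fE a) (allFin n)))
                                 (∑-∈ (∈-allFin b) (All.tabulate λ {t} _ → fE-nonneg a t))

  f≤f-in : ∀ {a b} → Edge a b → f a b ≤ f-in b
  f≤f-in {a} {b} ab = subst₂ _≤_ (fE-edge ab) (sym (sum-map (λ t → fE t b) (allFin n)))
                                (∑-∈ (∈-allFin a) (All.tabulate λ {t} _ → fE-nonneg t b))

  module _ {resolved D} (pd : PartialDecomposition resolved D) {P w} (P∈D : (P , w) ∈ D) where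

    private
      a : Admissible resolved (P , w)
      a = All.lookup (admissible pd) P∈D

    weight≤through : ∀ {Q} → Infix _≡_ Q P → w ≤ through D Q
    weight≤through {Q} Q⊑P =
      subst (_≤ through D Q) (when-yes (subpathOf? Q P) Q⊑P w)
            (∑-∈ P∈D (All.map (λ {(P′ , _)} a′ → when-nonneg (subpathOf? Q P′) (inj₁ (positive a′))) (admissible pd)))

    weight≤flow : ∀ {x y} → Infix _≡_ (x ∷ y ∷ []) P → w ≤ f x y
    weight≤flow xy⊑P = ≤-trans (weight≤through xy⊑P) (≤-reflexive (exact pd _ _ (Linked-infix (proj₂ (isPath a)) xy⊑P)))

    start-not-sink : ∀ {h} → StartsWith h P → ¬ IsSink h
    start-not-sink ([] , refl)     _    = single-not-path (isPath a)
    start-not-sink (h₂ ∷ Q , refl) sink =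
      ≤⇒≯ (≤-trans (weight≤flow first) (≤-trans (f≤f-out hh₂) (≤-reflexive sink))) (positive a)
      where
      first = ++⇒infix [] _ Q refl
      hh₂ = Linked-infix (proj₂ (isPath a)) first

    end-not-source : ∀ {t} → EndsWith t P → ¬ IsSource t
    end-not-source {t} (R , refl) source with nonempty⇒endsWith R (λ { refl → single-not-path (isPath a) })
    ... | t′ , R′ , refl =
      ≤⇒≯ (≤-trans (weight≤flow last) (≤-trans (f≤f-in t′t) (≤-reflexive source))) (positive a)
      where
      last = ++⇒infix R′ _ [] (++-assoc R′ (t′ ∷ []) (t ∷ []))
      t′t = Linked-infix (proj₂ (isPath a)) last

  complete⇒flowDecomposition : ∀ {resolved D} → PartialDecomposition resolved D → (∀ y → Internal y → y ∈ resolved) →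
                               IsFlowDecomposition D
  complete⇒flowDecomposition {D = D} pd complete = All.tabulate st-path , λ a b ab → trans (weightThrough≡through D _) (exact pd a b ab)
    where
    st-path : ∀ {Pw} → Pw ∈ D → IsSTPath (proj₁ Pw) × 0# < proj₂ Pw
    st-path {[] , w} P∈D with () ← proj₁ (isPath (All.lookup (admissible pd) P∈D))
    st-path {h ∷ Q , w} P∈D with t , R , e ← nonempty⇒endsWith (h ∷ Q) (λ ()) =
      (isPath a , source , R , t , e , sink) , positive a
      where
      a = All.lookup (admissible pd) P∈D
      source : IsSource h
      source = decidable-stable (f-in h ≈? 0#) λ ¬source →
        start∉ a h (Q , refl) (complete h (¬source , start-not-sink pd P∈D (Q , refl)))
      sink : IsSink t
      sink = decidable-stable (f-out t ≈? 0#) λ ¬sink →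
        end∉ a t (R , e) (complete t (end-not-source pd P∈D (R , e) , ¬sink))

  flowDecomposition : Σ (List WeightedPath) IsFlowDecomposition
  flowDecomposition with D , pd ← decomposeOutside [] =
    D , complete⇒flowDecomposition pd (λ y iy → internal⇒∈internalsOutside iy λ ())

  -- Safe paths

  safe⇒through-positive : ∀ {P Q D} → Safe P → IsFlowDecomposition D → Infix _≡_ Q P → 0# < through D Q
  safe⇒through-positive {P} {Q} {D} (w , 0<w , _ , safe) fd Q⊑P =
    <-≤-trans 0<w (≤-trans (subst (w ≤_) (weightThrough≡through D P) (safe D fd))
                           (through-antitone (All.map (inj₁ ∘ proj₂) (proj₁ fd)) Q⊑P))

  safe⇒flow-positive : ∀ {P a b} → Safe P → Infix _≡_ (a ∷ b ∷ []) P → 0# < f a b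
  safe⇒flow-positive {P} {a} {b} safe@(_ , _ , (_ , linked) , _) ab⊑P with D , fd ← flowDecomposition =
    subst (0# <_) (trans (sym (weightThrough≡through D _)) (proj₂ fd a b (Linked-infix linked ab⊑P)))
          (safe⇒through-positive safe fd ab⊑P)

  safe⇒internal : ∀ {P t u v} → Safe P → Infix _≡_ (t ∷ u ∷ v ∷ []) P → Internal u
  safe⇒internal {P} {t} {u} {v} safe@(_ , _ , (_ , linked) , _) tuv⊑P = ¬source , ¬sink
    where
    tu⊑P : Infix _≡_ (t ∷ u ∷ []) P
    tu⊑P = infix-trans (++⇒infix [] (t ∷ u ∷ []) (v ∷ []) refl) tuv⊑P
    uv⊑P : Infix _≡_ (u ∷ v ∷ []) P
    uv⊑P = infix-trans (++⇒infix (t ∷ []) (u ∷ v ∷ []) [] refl) tuv⊑P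
    ¬source : ¬ IsSource u
    ¬source source = ≤⇒≯ (subst (f t u ≤_) source (f≤f-in (Linked-infix linked tu⊑P))) (safe⇒flow-positive safe tu⊑P)
    ¬sink : ¬ IsSink u
    ¬sink sink = ≤⇒≯ (subst (f u v ≤_) sink (f≤f-out (Linked-infix linked uv⊑P))) (safe⇒flow-positive safe uv⊑P)

module ReroutingAlgebra (F : OrderedField) where
  open OrderedFieldProperties F

  rerouting-balance : ∀ {iN iO k TLC TL¬C TR¬v TRv} WLC WL¬C WR¬v WRv →
    TR¬v * iN ≡ 1# → TLC * iN + k ≡ 1# → TLC + TL¬C ≡ TR¬v + TRv → TL¬C * iO ≡ 1# →
    iN * (TR¬v * WLC + TLC * WR¬v) + (k * iO * (TR¬v * WL¬C + TL¬C * WR¬v) + iO * (TRv * WL¬C + TL¬C * WRv))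
      ≡ WLC + WL¬C + (WR¬v + WRv)
  rerouting-balance {iN} {iO} {k} {TLC} {TL¬C} {TR¬v} {TRv} WLC WL¬C WR¬v WRv TR¬v*iN≡1 TLC*iN+k≡1 balance TL¬C*iO≡1 = begin
    iN * (TR¬v * WLC + TLC * WR¬v) + (k * iO * (TR¬v * WL¬C + TL¬C * WR¬v) + iO * (TRv * WL¬C + TL¬C * WRv))
      ≡⟨ collect iN iO k TLC TL¬C TR¬v TRv WLC WL¬C WR¬v WRv ⟩
    WLC * (TR¬v * iN) + WR¬v * (TLC * iN + k * (TL¬C * iO)) + WL¬C * (iO * (k * TR¬v + TRv)) + WRv * (TL¬C * iO)
      ≡⟨ cong₂ (λ x y → WLC * x + WR¬v * (TLC * iN + k * y) + WL¬C * (iO * (k * TR¬v + TRv)) + WRv * y) TR¬v*iN≡1 TL¬C*iO≡1 ⟩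
    WLC * 1# + WR¬v * (TLC * iN + k * 1#) + WL¬C * (iO * (k * TR¬v + TRv)) + WRv * 1#
      ≡⟨ cong₂ (λ x y → WLC * 1# + WR¬v * x + WL¬C * y + WRv * 1#)
               (trans (cong (TLC * iN +_) (*-identityʳ k)) TLC*iN+k≡1)
               (trans (cong (iO *_) kTR¬v+TRv≡TL¬C) (trans (*-comm iO TL¬C) TL¬C*iO≡1)) ⟩
    WLC * 1# + WR¬v * 1# + WL¬C * 1# + WRv * 1#
      ≡⟨ tidy WLC WL¬C WR¬v WRv ⟩
    WLC + WL¬C + (WR¬v + WRv) ∎
    where
    open ≡-Reasoning
    collect : ∀ iN iO k TLC TL¬C TR¬v TRv WLC WL¬C WR¬v WRv →
      iN * (TR¬v * WLC + TLC * WR¬v) + (k * iO * (TR¬v * WL¬C + TL¬C * WR¬v) + iO * (TRv * WL¬C + TL¬C * WRv))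
        ≡ WLC * (TR¬v * iN) + WR¬v * (TLC * iN + k * (TL¬C * iO)) + WL¬C * (iO * (k * TR¬v + TRv)) + WRv * (TL¬C * iO)
    collect = solve 11 (λ iN iO k TLC TL¬C TR¬v TRv WLC WL¬C WR¬v WRv →
      iN :* (TR¬v :* WLC :+ TLC :* WR¬v) :+ (k :* iO :* (TR¬v :* WL¬C :+ TL¬C :* WR¬v) :+ iO :* (TRv :* WL¬C :+ TL¬C :* WRv))
        := WLC :* (TR¬v :* iN) :+ WR¬v :* (TLC :* iN :+ k :* (TL¬C :* iO)) :+ WL¬C :* (iO :* (k :* TR¬v :+ TRv)) :+ WRv :* (TL¬C :* iO)) refl
    tidy : ∀ a b c d → a * 1# + c * 1# + b * 1# + d * 1# ≡ a + b + (c + d)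
    tidy = solve 4 (λ a b c d → a :* con 1 :+ c :* con 1 :+ b :* con 1 :+ d :* con 1 := a :+ b :+ (c :+ d)) refl
    kTR¬v+TRv≡TL¬C : k * TR¬v + TRv ≡ TL¬C
    kTR¬v+TRv≡TL¬C = +-cancelʳ TLC (begin
      k * TR¬v + TRv + TLC                    ≡⟨ sym (cong (k * TR¬v + TRv +_) (trans (cong (TLC *_) TR¬v*iN≡1) (*-identityʳ TLC))) ⟩
      k * TR¬v + TRv + TLC * (TR¬v * iN)       ≡⟨ solve 5 (λ iN k TLC TR¬v TRv → k :* TR¬v :+ TRv :+ TLC :* (TR¬v :* iN)
                                                           := (TLC :* iN :+ k) :* TR¬v :+ TRv) refl iN k TLC TR¬v TRv ⟩
      (TLC * iN + k) * TR¬v + TRv             ≡⟨ cong (λ x → x * TR¬v + TRv) TLC*iN+k≡1 ⟩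
      1# * TR¬v + TRv                         ≡⟨ cong (_+ TRv) (*-identityˡ TR¬v) ⟩
      TR¬v + TRv                              ≡⟨ sym balance ⟩
      TLC + TL¬C                              ≡⟨ +-comm TLC TL¬C ⟩
      TL¬C + TLC                              ∎)

  rerouting-balance₀ : ∀ {iN iO k TLC TL¬C TR¬v TRv} WLC WL¬C WR¬v WRv →
    TR¬v * iN ≡ 1# → TLC ≡ TR¬v → iO ≡ 0# → WL¬C ≡ 0# → WRv ≡ 0# →
    iN * (TR¬v * WLC + TLC * WR¬v) + (k * iO * (TR¬v * WL¬C + TL¬C * WR¬v) + iO * (TRv * WL¬C + TL¬C * WRv))
      ≡ WLC + WL¬C + (WR¬v + WRv)
  rerouting-balance₀ {iN} {k = k} {TL¬C = TL¬C} {TR¬v} {TRv} WLC _ WR¬v _ TR¬v*iN≡1 refl refl refl refl =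
    trans (solve 7 (λ iN k TL¬C TR¬v TRv WLC WR¬v →
             iN :* (TR¬v :* WLC :+ TR¬v :* WR¬v) :+ (k :* con 0 :* (TR¬v :* con 0 :+ TL¬C :* WR¬v) :+ con 0 :* (TRv :* con 0 :+ TL¬C :* con 0))
               := (TR¬v :* iN) :* (WLC :+ WR¬v)) refl iN k TL¬C TR¬v TRv WLC WR¬v)
   (trans (cong (_* (WLC + WR¬v)) TR¬v*iN≡1)
   (trans (*-identityˡ _) (solve 2 (λ a b → a :+ b := a :+ con 0 :+ (b :+ con 0)) refl WLC WR¬v)))

module Rerouting (F : OrderedField) {n : ℕ} (E : Fin n → Fin n → Bool)
                 (f : Fin n → Fin n → OrderedField.Carrier F) (flowGraph : Flow.IsFlowGraph F E f) where
  open OrderedFieldProperties F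
  open ReroutingAlgebra F
  open Graph E
  open Flow F E f
  open AcyclicPaths E (proj₁ flowGraph)
  open Decomposition F E f flowGraph
  open Admissible
  open PartialDecomposition

  module AtVertex {resolved D} (pd : PartialDecomposition resolved D) {u} (u∉ : u ∉ resolved) (internal : Internal u)
           {v w′} (uv : Edge u v) (uw′ : Edge u w′) (w′≢v : w′ ≢ v) (fuv≤fuw′ : f u v ≤ f u w′) where

    L R O : List WeightedPath
    L = endingAt u D
    R = startingAt u D
    O = avoiding u D

    UsesUV : WeightedPath → Set
    UsesUV (P , _) = Infix _≡_ (u ∷ v ∷ []) P

    usesUV? : Decidable UsesUV
    usesUV? (P , _) = subpathOf? (u ∷ v ∷ []) P

    Rv R¬v : List WeightedPath
    Rv = filter usesUV? R
    R¬v = filter (¬? ∘ usesUV?) R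

    TL≡TRv+TR¬v : total L ≡ total Rv + total R¬v
    TL≡TRv+TR¬v = trans (total-in≡total-out pd u∉ internal) (∑-partition usesUV? proj₂ R)

    through-R-out : ∀ x → Edge u x → through R (u ∷ x ∷ []) ≡ f u x
    through-R-out x ux = begin
      through R e                               ≡⟨ sym (+-identityˡ _) ⟩
      0# + through R e                          ≡⟨ cong (_+ through R e) (sym (trans (cong₂ _+_ O-out L-out) (+-identityʳ 0#))) ⟩
      through O e + through L e + through R e   ≡⟨ sym (through-split-at pd u u∉ e) ⟩
      through D e                               ≡⟨ exact pd u x ux ⟩
      f u x                                     ∎
      where
      open ≡-Reasoning
      e = u ∷ x ∷ []
      O-out : through O e ≡ 0#
      O-out = through-absent (All.map (λ u∉P i → u∉P (infix⇒∈ i)) (All.all-filter (avoids? u) D))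
      L-out : through L e ≡ 0#
      L-out = through-absent (All.map (λ (a , P≡) → u-last (proj₂ (isPath a)) P≡) (endingAt-admissible pd u))
        where
        u-last : ∀ {P} → Linked Edge P → EndsWith u P → ¬ Infix _≡_ e P
        u-last l (R′ , P≡) i with X , Y , e′ ← infix⇒++ i with () ← proj₂ (position-unique X R′ l e′ P≡)

    TRv≡fuv : total Rv ≡ f u v
    TRv≡fuv = trans (∑-filter usesUV? proj₂ R) (through-R-out v uv)

    fuw′≤TR¬v : f u w′ ≤ total R¬v
    fuw′≤TR¬v = subst (_≤ total R¬v) (begin
      through R¬v e                ≡⟨ sym (+-identityˡ _) ⟩
      0# + through R¬v e           ≡⟨ cong (_+ through R¬v e) (sym Rv-avoids) ⟩
      through Rv e + through R¬v e ≡⟨ sym (∑-partition usesUV? (share e) R) ⟩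
      through R e                  ≡⟨ through-R-out w′ uw′ ⟩
      f u w′                       ∎)
      (through≤total e (weights-nonneg (All.filter⁺ _ (All.map proj₁ (startingAt-admissible pd u)))))
      where
      open ≡-Reasoning
      e = u ∷ w′ ∷ []
      Rv-avoids : through Rv e ≡ 0#
      Rv-avoids = through-absent
        (All.map (λ (a , uv⊑P) i → w′≢v (second (proj₂ (isPath a)) i uv⊑P))
                 (All.zip (All.filter⁺ usesUV? (All.map proj₁ (startingAt-admissible pd u)) , All.all-filter usesUV? R)))
        where
        second : ∀ {P} → Linked Edge P → Infix _≡_ e P → Infix _≡_ (u ∷ v ∷ []) P → w′ ≡ v
        second l i j with X , Y , e₁ ← infix⇒++ i | X′ , Y′ , e₂ ← infix⇒++ j =
          proj₁ (∷-injective (proj₂ (position-unique X X′ l e₁ e₂)))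

    TRv≤TR¬v : total Rv ≤ total R¬v
    TRv≤TR¬v = ≤-trans (≤-reflexive TRv≡fuv) (≤-trans fuv≤fuw′ fuw′≤TR¬v)

    0<TR¬v : 0# < total R¬v
    0<TR¬v with 0# <? total R¬v
    ... | yes 0<TR¬v = 0<TR¬v
    ... | no 0≮TR¬v = ⊥-elim (≤⇒≯ TL≤0 (0<total-in pd u∉ internal))
      where
      TL≤0 : total L ≤ 0#
      TL≤0 = subst₂ _≤_ (sym TL≡TRv+TR¬v) (+-identityʳ 0#)
                    (+-mono-≤ (≤-trans TRv≤TR¬v (≮⇒≥ 0≮TR¬v)) (≮⇒≥ 0≮TR¬v))

    ArrivesVia : List (Fin n) → WeightedPath → Set
    ArrivesVia C (P , _) = Suffix _≡_ (C ∷ʳ u) P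

    arrivesVia? : ∀ C → Decidable (ArrivesVia C)
    arrivesVia? C (P , _) = Suffix.suffix? _≟_ (C ∷ʳ u) P

    arrivingVia arrivingOtherwise : List (Fin n) → List WeightedPath
    arrivingVia       C = filter (arrivesVia? C) L
    arrivingOtherwise C = filter (¬? ∘ arrivesVia? C) L

    -- The paths of L arriving through two different predecessors of a common chain K are disjoint
    -- families whose weights sum to at most total L ≤ 2 total R¬v.
    some-branch-fits : ∀ {a b} K → a ≢ b →
                       total (arrivingVia (a ∷ K)) ≤ total R¬v ⊎ total (arrivingVia (b ∷ K)) ≤ total R¬v
    some-branch-fits {a} {b} K a≢b with total R¬v <? total (arrivingVia (a ∷ K)) | total R¬v <? total (arrivingVia (b ∷ K))
    ... | no R¬v≮A  | _         = inj₁ (≮⇒≥ R¬v≮A)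
    ... | yes _    | no R¬v≮B  = inj₂ (≮⇒≥ R¬v≮B)
    ... | yes R¬v<A | yes R¬v<B = ⊥-elim (≤⇒≯ A+B≤TL TL<A+B)
      where
      via : List (Fin n) → WeightedPath → Carrier
      via C Pw = when (arrivesVia? C Pw) (proj₂ Pw)
      A+B≤TL : total (arrivingVia (a ∷ K)) + total (arrivingVia (b ∷ K)) ≤ total L
      A+B≤TL = subst (_≤ total L)
        (trans (∑-+ (via (a ∷ K)) (via (b ∷ K)) L)
               (sym (cong₂ _+_ (∑-filter (arrivesVia? (a ∷ K)) proj₂ L) (∑-filter (arrivesVia? (b ∷ K)) proj₂ L))))
        (∑-mono {h = λ Pw → via (a ∷ K) Pw + via (b ∷ K) Pw} {g = proj₂}
          (All.map (λ {Pw} (a′ , _) → when-disjoint (arrivesVia? (a ∷ K) Pw) (arrivesVia? (b ∷ K) Pw) (inj₁ (positive a′))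
                                        (λ s₁ s₂ → a≢b (suffix-∷-unique (K ∷ʳ u) s₁ s₂)))
                   (endingAt-admissible pd u)))
      TL<A+B : total L < total (arrivingVia (a ∷ K)) + total (arrivingVia (b ∷ K))
      TL<A+B = ≤-<-trans (≤-trans (≤-reflexive TL≡TRv+TR¬v) (+-monoˡ-≤ (total R¬v) TRv≤TR¬v))
                         (+-mono-<-≤ R¬v<A (inj₁ R¬v<B))

    AvoidingDecomposition : List (Fin n) → Set
    AvoidingDecomposition C =
      Σ (List WeightedPath) λ D′ → PartialDecomposition (u ∷ resolved) D′ × through D′ (C ++ u ∷ v ∷ []) ≡ 0#

    -- LC is spliced only with R¬v, filling the fraction total LC / total R¬v of each of its paths, and L¬C
    -- fills the rest of R¬v and all of Rv.  Hence no resulting path arrives through C and continues to v.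
    module Reroute (C : List (Fin n)) (fits : total (arrivingVia C) ≤ total R¬v) where

      LC L¬C : List WeightedPath
      LC = arrivingVia C
      L¬C = arrivingOtherwise C

      iN iO k : Carrier
      iN = total R¬v ⁻¹
      iO = total L¬C ⁻¹
      k  = 1# - total LC * iN

      TR¬v*iN≡1 : total R¬v * iN ≡ 1#
      TR¬v*iN≡1 = *-inverseʳ (<⇒≢ 0<TR¬v ∘ sym)

      TLC*iN+k≡1 : total LC * iN + k ≡ 1#
      TLC*iN+k≡1 = trans (+-comm _ k) (-+-cancel (total LC * iN) 1#)

      0≤k : 0# ≤ k
      0≤k = ≤⇒0≤- (≤-trans (*-monoˡ-≤ (inj₁ (⁻¹-pos 0<TR¬v)) fits) (≤-reflexive TR¬v*iN≡1))

      TL≡TLC+TL¬C : total L ≡ total LC + total L¬C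
      TL≡TLC+TL¬C = ∑-partition (arrivesVia? C) proj₂ L

      LC-ending : All (λ Pw → Admissible resolved Pw × EndsAt u Pw) LC
      LC-ending = All.filter⁺ (arrivesVia? C) (endingAt-admissible pd u)
      L¬C-ending : All (λ Pw → Admissible resolved Pw × EndsAt u Pw) L¬C
      L¬C-ending = All.filter⁺ (¬? ∘ arrivesVia? C) (endingAt-admissible pd u)
      R¬v-starting : All (λ Pw → Admissible resolved Pw × StartsAt u Pw) R¬v
      R¬v-starting = All.filter⁺ (¬? ∘ usesUV?) (startingAt-admissible pd u)
      Rv-starting : All (λ Pw → Admissible resolved Pw × StartsAt u Pw) Rv
      Rv-starting = All.filter⁺ usesUV? (startingAt-admissible pd u)

      J₁ J₂ J₃ X : List WeightedPath
      J₁ = splices LC R¬v iN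
      J₂ = splices L¬C R¬v (k * iO)
      J₃ = splices L¬C Rv iO
      X  = J₁ ++ J₂ ++ J₃

      D′ : List WeightedPath
      D′ = O ++ positivePart X

      X-nonneg : All (λ Pw → 0# ≤ proj₂ Pw) X
      X-nonneg = All.++⁺ (family (inj₁ (⁻¹-pos 0<TR¬v)) LC-ending R¬v-starting)
                (All.++⁺ (family (*-nonneg 0≤k (⁻¹-nonneg (total-nonneg (All.map proj₁ L¬C-ending)))) L¬C-ending R¬v-starting)
                         (family (⁻¹-nonneg (total-nonneg (All.map proj₁ L¬C-ending))) L¬C-ending Rv-starting))
        where
        family : ∀ {L′ R′ c} → 0# ≤ c → All (λ Pw → Admissible resolved Pw × EndsAt u Pw) L′ →
                 All (λ Pw → Admissible resolved Pw × StartsAt u Pw) R′ → All (λ Pw → 0# ≤ proj₂ Pw) (splices L′ R′ c)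
        family 0≤c = All-splices (λ (a , _) (a′ , _) → *-nonneg (*-nonneg (inj₁ (positive a)) (inj₁ (positive a′))) 0≤c)

      X-admissible : All (λ Pw → 0# < proj₂ Pw → Admissible (u ∷ resolved) Pw) X
      X-admissible = All.++⁺ (family LC-ending R¬v-starting) (All.++⁺ (family L¬C-ending R¬v-starting) (family L¬C-ending Rv-starting))
        where
        family : ∀ {L′ R′ c} → All (λ Pw → Admissible resolved Pw × EndsAt u Pw) L′ →
                 All (λ Pw → Admissible resolved Pw × StartsAt u Pw) R′ →
                 All (λ Pw → 0# < proj₂ Pw → Admissible (u ∷ resolved) Pw) (splices L′ R′ c)
        family = All-splices (λ pa sa → splice-admissible u∉ pa sa)

      Cuv : List (Fin n)
      Cuv = C ++ u ∷ v ∷ []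

      X-avoids : All (λ Pw → ¬ Infix _≡_ Cuv (proj₁ Pw)) X
      X-avoids = All.++⁺ (All-splices (λ ((a , en) , _) ((a′ , st) , ¬uv) i →
                                          ¬uv (proj₂ (splice-chain C en (proj₂ (isPath a)) st (proj₂ (isPath a′)) i)))
                                       (All.zip (LC-ending , All.all-filter (arrivesVia? C) L))
                                       (All.zip (R¬v-starting , All.all-filter (¬? ∘ usesUV?) R)))
                 (All.++⁺ (from-L¬C R¬v-starting) (from-L¬C Rv-starting))
        where
        from-L¬C : ∀ {R′ c} → All (λ Pw → Admissible resolved Pw × StartsAt u Pw) R′ →
                  All (λ Pw → ¬ Infix _≡_ Cuv (proj₁ Pw)) (splices L¬C R′ c)
        from-L¬C = All-splices (λ ((a , en) , ¬via) (a′ , st) i →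
                                 ¬via (proj₁ (splice-chain C en (proj₂ (isPath a)) st (proj₂ (isPath a′)) i)))
                              (All.zip (L¬C-ending , All.all-filter (¬? ∘ arrivesVia? C) L))

      D′-avoids : through D′ Cuv ≡ 0#
      D′-avoids = through-absent (All.++⁺ (All.map (λ u∉P i → u∉P (infix⇒∈ (infix-trans (infix-++ʳ C (u ∷ v ∷ [])) i)))
                                                   (All.all-filter (avoids? u) D))
                                          (All.filter⁺ ((0# <?_) ∘ proj₂) X-avoids))

      D′-admissible : All (Admissible (u ∷ resolved)) D′
      D′-admissible = All.++⁺ (avoidingAt-admissible pd u)
        (All.map (λ (adm , 0<w) → adm 0<w)
                 (All.zip (All.filter⁺ ((0# <?_) ∘ proj₂) X-admissible , All.all-filter ((0# <?_) ∘ proj₂) X)))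

      degenerate : total L¬C ≡ 0# → total LC ≡ total R¬v × total Rv ≡ 0#
      degenerate TL¬C≡0 = TLC≡TR¬v , TRv≡0
        where
        TLC≡TL : total LC ≡ total L
        TLC≡TL = sym (trans TL≡TLC+TL¬C (trans (cong (total LC +_) TL¬C≡0) (+-identityʳ _)))
        TLC≡TR¬v : total LC ≡ total R¬v
        TLC≡TR¬v = ≤-antisym fits (subst₂ _≤_ (+-identityˡ (total R¬v)) (trans (sym TL≡TRv+TR¬v) (sym TLC≡TL))
                                          (+-monoˡ-≤ (total R¬v) (total-nonneg (All.map proj₁ Rv-starting))))
        TRv≡0 : total Rv ≡ 0#
        TRv≡0 = +-cancelʳ (total R¬v) (trans (sym TL≡TRv+TR¬v) (trans (sym TLC≡TL) (trans TLC≡TR¬v (sym (+-identityˡ _)))))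

      through-X : ∀ a b → through X (a ∷ b ∷ []) ≡
                  through LC (a ∷ b ∷ []) + through L¬C (a ∷ b ∷ []) + (through R¬v (a ∷ b ∷ []) + through Rv (a ∷ b ∷ []))
      through-X a b = begin
        through X e
          ≡⟨ trans (∑-++ (share e) J₁ (J₂ ++ J₃)) (cong (through J₁ e +_) (∑-++ (share e) J₂ J₃)) ⟩
        through J₁ e + (through J₂ e + through J₃ e)
          ≡⟨ cong₂ _+_ (through-splices LC R¬v iN (linked-ends LC-ending) (linked-starts R¬v-starting) a b)
                       (cong₂ _+_ (through-splices L¬C R¬v (k * iO) (linked-ends L¬C-ending) (linked-starts R¬v-starting) a b)
                                  (through-splices L¬C Rv iO (linked-ends L¬C-ending) (linked-starts Rv-starting) a b)) ⟩
        iN * (total R¬v * WLC + total LC * WR¬v) + (k * iO * (total R¬v * WL¬C + total L¬C * WR¬v) + iO * (total Rv * WL¬C + total L¬C * WRv))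
          ≡⟨ balance (total L¬C ≈? 0#) ⟩
        WLC + WL¬C + (WR¬v + WRv) ∎
        where
        open ≡-Reasoning
        e = a ∷ b ∷ []
        WLC = through LC e
        WL¬C = through L¬C e
        WR¬v = through R¬v e
        WRv = through Rv e
        balance : Dec (total L¬C ≡ 0#) →
                  iN * (total R¬v * WLC + total LC * WR¬v) + (k * iO * (total R¬v * WL¬C + total L¬C * WR¬v) + iO * (total Rv * WL¬C + total L¬C * WRv))
                    ≡ WLC + WL¬C + (WR¬v + WRv)
        balance (no TL¬C≢0) = rerouting-balance WLC WL¬C WR¬v WRv TR¬v*iN≡1 TLC*iN+k≡1
                                (trans (sym TL≡TLC+TL¬C) (trans TL≡TRv+TR¬v (+-comm _ _))) (*-inverseʳ TL¬C≢0)
        balance (yes TL¬C≡0) =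
          rerouting-balance₀ WLC WL¬C WR¬v WRv TR¬v*iN≡1 (proj₁ (degenerate TL¬C≡0)) (trans (cong _⁻¹ TL¬C≡0) 0⁻¹≡0)
            (total≡0⇒through≡0 e (weights-nonneg (All.map proj₁ L¬C-ending)) TL¬C≡0)
            (total≡0⇒through≡0 e (weights-nonneg (All.map proj₁ Rv-starting)) (proj₂ (degenerate TL¬C≡0)))

      D′-exact : ∀ a b → Edge a b → through D′ (a ∷ b ∷ []) ≡ f a b
      D′-exact a b ab = begin
        through D′ e
          ≡⟨ ∑-++ (share e) O (positivePart X) ⟩
        through O e + through (positivePart X) e
          ≡⟨ cong (through O e +_) (trans (through-positivePart e X-nonneg) (through-X a b)) ⟩
        through O e + (through LC e + through L¬C e + (through R¬v e + through Rv e))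
          ≡⟨ cong (through O e +_) (cong₂ _+_ (sym (∑-partition (arrivesVia? C) (share e) L))
                                             (trans (+-comm _ _) (sym (∑-partition usesUV? (share e) R)))) ⟩
        through O e + (through L e + through R e) ≡⟨ sym (+-assoc _ _ _) ⟩
        through O e + through L e + through R e   ≡⟨ sym (through-split-at pd u u∉ e) ⟩
        through D e                               ≡⟨ exact pd a b ab ⟩
        f a b                                     ∎
        where
        open ≡-Reasoning
        e = a ∷ b ∷ []

    reroute : ∀ C → total (arrivingVia C) ≤ total R¬v → AvoidingDecomposition C
    reroute C fits = D′ , mkPartialDecomposition D′-admissible D′-exact , D′-avoids
      where open Reroute C fits

    unused-chain : (∀ y → Internal y → y ∈ u ∷ resolved) → ∀ R C → Safe (R ++ C ++ u ∷ v ∷ []) →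
                   total (arrivingVia C) ≤ total R¬v → ⊥
    unused-chain complete R C safe fits = refute (reroute C fits)
      where
      refute : AvoidingDecomposition C → ⊥
      refute (D′ , pd′ , through≡0) =
        <⇒≢ (safe⇒through-positive safe (complete⇒flowDecomposition pd′ complete) (infix-++ʳ R _)) (sym through≡0)

    chains-not-both-safe : (∀ y → Internal y → y ∈ u ∷ resolved) → ∀ {a b} K R₁ R₂ → a ≢ b →
                           Safe (R₁ ++ a ∷ K ++ u ∷ v ∷ []) → Safe (R₂ ++ b ∷ K ++ u ∷ v ∷ []) → ⊥
    chains-not-both-safe complete {a} {b} K R₁ R₂ a≢b safe₁ safe₂ =
      [ unused-chain complete R₁ (a ∷ K) safe₁ , unused-chain complete R₂ (b ∷ K) safe₂ ]′ (some-branch-fits K a≢b)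

module DivergingSafePaths (F : OrderedField) {n : ℕ} (E : Fin n → Fin n → Bool)
                           (f : Fin n → Fin n → OrderedField.Carrier F) (flowGraph : Flow.IsFlowGraph F E f) where
  open OrderedFieldProperties F
  open Graph E
  open Flow F E f
  open Decomposition F E f flowGraph
  open Rerouting F E f flowGraph
  open import Data.List.Membership.DecPropositional (_≟_ {n}) using (_∈?_)

  module _ {u v : Fin n} where

    Dominated : Fin n → Set
    Dominated w = Edge u w → w ≢ v → f u w < f u v

    competitor : Edge u v → ¬ UniqueMaxOut u v → ∃ λ w′ → Edge u w′ × w′ ≢ v × f u v ≤ f u w′
    competitor uv ¬max with ¬∀⟶∃¬ n Dominated (λ w → edge? u w →-dec (¬? (w ≟ v) →-dec (f u w <? f u v)))
                                    (λ dominated → ¬max (uv , dominated))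
    ... | w′ , ¬dominated with edge? u w′ | w′ ≟ v
    ...   | no ¬uw′ | _        = ⊥-elim (¬dominated λ uw′ → ⊥-elim (¬uw′ uw′))
    ...   | yes _   | yes w′≡v = ⊥-elim (¬dominated λ _ w′≢v → ⊥-elim (w′≢v w′≡v))
    ...   | yes uw′ | no w′≢v  = w′ , uw′ , w′≢v , ≮⇒≥ (λ fuw′<fuv → ¬dominated λ _ _ → fuw′<fuv)

  predecessor-exists : ∀ R a K {u v : Fin n} → ∃ λ t → Infix _≡_ (t ∷ u ∷ v ∷ []) (R ++ a ∷ K ++ u ∷ v ∷ [])
  predecessor-exists R a K {u} {v} with t , K′ , a∷K≡ ← nonempty⇒endsWith (a ∷ K) (λ ()) =
    t , ++⇒infix (R ++ K′) _ [] (begin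
      R ++ (a ∷ K) ++ u ∷ v ∷ []       ≡⟨ cong (λ X → R ++ X ++ u ∷ v ∷ []) a∷K≡ ⟩
      R ++ (K′ ∷ʳ t) ++ u ∷ v ∷ []     ≡⟨ cong (R ++_) (++-assoc K′ (t ∷ []) (u ∷ v ∷ [])) ⟩
      R ++ K′ ++ t ∷ u ∷ v ∷ []        ≡⟨ sym (++-assoc R K′ _) ⟩
      (R ++ K′) ++ t ∷ u ∷ v ∷ []      ∎)
    where open ≡-Reasoning

  diverging-safe-paths⇒⊥ : ∀ {u v} → Edge u v → ¬ UniqueMaxOut u v → ∀ {a b} K R₁ R₂ → a ≢ b →
                             Safe (R₁ ++ a ∷ K ++ u ∷ v ∷ []) → Safe (R₂ ++ b ∷ K ++ u ∷ v ∷ []) → ⊥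
  diverging-safe-paths⇒⊥ {u} {v} uv ¬max K R₁ R₂ a≢b safe₁ safe₂ with competitor uv ¬max
  ... | w′ , uw′ , w′≢v , fuv≤fuw′ =
    AtVertex.chains-not-both-safe (proj₂ (decomposeOutside (u ∷ []))) u∉ (safe⇒internal safe₁ (proj₂ (predecessor-exists R₁ _ K)))
                                  uv uw′ w′≢v fuv≤fuw′ complete K R₁ R₂ a≢b safe₁ safe₂
    where
    u∉ : u ∉ internalsOutside (u ∷ [])
    u∉ u∈ = ∈internalsOutside⇒∉ u∈ (here refl)
    complete : ∀ y → Internal y → y ∈ u ∷ internalsOutside (u ∷ [])
    complete y iy with y ≟ u
    ... | yes refl = here refl
    ... | no y≢u   = there (internal⇒∈internalsOutside iy λ { (here y≡u) → y≢u y≡u })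

lemma9 : (F : OrderedField) {n : ℕ} (E : Fin n → Fin n → Bool)
         (f : Fin n → Fin n → OrderedField.Carrier F) →
         Flow.IsFlowGraph F E f →
         (u v : Fin n) → Graph.Edge E u v →
         ¬ Flow.UniqueMaxOut F E f u v →
         (P₁ P₂ : List (Fin n)) →
         Flow.Safe F E f P₁ → Graph.LastEdge E P₁ u v →
         Flow.Safe F E f P₂ → Graph.LastEdge E P₂ u v →
         Graph.SuffixOf E P₁ P₂ ⊎ Graph.SuffixOf E P₂ P₁
lemma9 F E f flowGraph u v uv ¬max _ _ safe₁ (xs₁ , refl) safe₂ (xs₂ , refl) with suffix-or-diverge _≟_ xs₁ xs₂
... | inj₁ xs₁⊒xs₂        = inj₁ (Suffix.++⁺ xs₁⊒xs₂ (≡⇒Pointwise-≡ refl))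
... | inj₂ (inj₁ xs₂⊒xs₁) = inj₂ (Suffix.++⁺ xs₂⊒xs₁ (≡⇒Pointwise-≡ refl))
... | inj₂ (inj₂ (K , a , b , R₁ , R₂ , a≢b , refl , refl)) =
  ⊥-elim (diverging-safe-paths⇒⊥ uv ¬max K R₁ R₂ a≢b (reassoc R₁ a safe₁) (reassoc R₂ b safe₂))
  where
  open DivergingSafePaths F E f flowGraph
  reassoc : ∀ R c → Flow.Safe F E f ((R ++ c ∷ K) ++ u ∷ v ∷ []) → Flow.Safe F E f (R ++ c ∷ K ++ u ∷ v ∷ [])
  reassoc R c = subst (Flow.Safe F E f) (++-assoc R (c ∷ K) (u ∷ v ∷ []))
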